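{- For every odd positive integer $n$, $$\sum_{\substack{\phi\vDash[n]\\ \phi \text{ odd}}}2^{\,n-\ell(\phi)}\,\mu_{\ell(\phi)+1}=(-1)^{\frac{n-1}{2}}E_n,$$ where the sum runs over all odd set compositions $\phi$ of $[n]=\{1,\dots,n\}$.
   Context: A set composition $\phi=\phi_1/\phi_2/\cdots/\phi_\ell\vDash[n]$ of $[n]$ is an ordered list of mutually disjoint nonempty subsets (blocks) of $[n]$ whose union is $[n]$; $\ell(\phi)$ denotes its number of blocks. The set composition $\phi$ is called odd if every block has odd cardinality (so for odd $n$, $\ell(\phi)+1$ is even). For an even positive integer $\ell$, $\mu_\ell=(-1)^{\frac{\ell}{2}-1}C_{\frac{\ell}{2}-1}$, where $C_m=\frac{1}{m+1}\binom{2m}{m}$ is the $m$-th Catalan number. The Euler numbers $E_n$ are defined by $\tan(x)+\sec(x)=\sum_{n\ge 0}E_n\frac{x^n}{n!}$. -}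

module Defs where

open import Data.Bool using (Bool; true; false; _∧_; if_then_else_)
open import Data.Nat as ℕ using (ℕ; zero; suc; _∸_; _≡ᵇ_; _!)
open import Data.Nat.Properties using (_!≢0)
open import Data.Nat.Combinatorics using (_C_)
open import Data.Integer as ℤ using (ℤ; +_)
open import Data.Rational as ℚ using (ℚ; _+_; _*_; -_; 0ℚ; 1ℚ)
open import Data.List as List using (List; []; _∷_; map; concatMap; filter; upTo; zipWith; length; foldr; applyUpTo)
open import Data.Vec as Vec using (Vec; []; _∷_; toList)
open import Data.Fin using (Fin)
open import Data.Fin.Subset using (Subset; inside; outside; ∣_∣)
open import Data.Fin.Subset.Properties using (_∈?_)
open import Relation.Nullary.Decidable using (⌊_⌋)

sumℚ : List ℚ → ℚ
sumℚ = foldr _+_ 0ℚ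

ℕtoℚ : ℕ → ℚ
ℕtoℚ k = (+ k) ℚ./ 1

signℚ : ℕ → ℚ
signℚ zero    = 1ℚ
signℚ (suc k) = - signℚ k

catalan : ℕ → ℚ
catalan m = ℕtoℚ ((2 ℕ.* m) C m) * ((+ 1) ℚ./ suc m)

-- μ_ℓ = (-1)^(ℓ/2 - 1) C_(ℓ/2 - 1) for even positive ℓ.
-- (Only ever applied to even positive ℓ; value 0 otherwise is a dummy.)
μ : ℕ → ℚ
μ ℓ = if (ℓ ℕ.% 2 ≡ᵇ 0) ∧ ⌊ 1 ℕ.≤? ℓ ⌋
        then signℚ ((ℓ ℕ./ 2) ∸ 1) * catalan ((ℓ ℕ./ 2) ∸ 1)
        else 0ℚ

Series : Set
Series = ℕ → ℚ

invFact : ℕ → ℚ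
invFact k = (+ 1) ℚ./ (k !)
  where instance _ = k !≢0

isEven : ℕ → Bool
isEven k = k ℕ.% 2 ≡ᵇ 0

sinS : Series
sinS k = if isEven k then 0ℚ else signℚ ((k ∸ 1) ℕ./ 2) * invFact k

cosS : Series
cosS k = if isEven k then signℚ (k ℕ./ 2) * invFact k else 0ℚ

oneS : Series
oneS zero    = 1ℚ
oneS (suc _) = 0ℚ

_+S_ : Series → Series → Series
(f +S g) k = f k + g k

_*S_ : Series → Series → Series
(f *S g) k = sumℚ (map (λ i → f i * g (k ∸ i)) (upTo (suc k)))

-- Reciprocal of a series with constant term 1:
-- h 0 = 1, h k = - Σ_{i=1}^{k} g i * h (k - i).
-- invPrefix g k = [h k, h (k-1), …, h 0]
invPrefix : Series → ℕ → List ℚ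
invPrefix g zero    = 1ℚ ∷ []
invPrefix g (suc k) =
  let prev = invPrefix g k in
  (- sumℚ (zipWith (λ i h → g i * h) (applyUpTo suc (suc k)) prev)) ∷ prev

headℚ : List ℚ → ℚ
headℚ []      = 0ℚ
headℚ (x ∷ _) = x

invS : Series → Series
invS g k = headℚ (invPrefix g k)

-- tan + sec = sin/cos + 1/cos = (sin + 1) * (1/cos)
tanPlusSec : Series
tanPlusSec = (sinS +S oneS) *S invS cosS

euler : ℕ → ℚ
euler n = ℕtoℚ (n !) * tanPlusSec n

allSubsets : (n : ℕ) → List (Subset n)
allSubsets zero    = [] ∷ []
allSubsets (suc n) = map (inside ∷_) (allSubsets n) List.++ map (outside ∷_) (allSubsets n)

subsetLists : (n ℓ : ℕ) → List (List (Subset n))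
subsetLists n zero    = [] ∷ []
subsetLists n (suc ℓ) = concatMap (λ s → map (s ∷_) (subsetLists n ℓ)) (allSubsets n)

allB : {A : Set} → (A → Bool) → List A → Bool
allB p = foldr (λ x b → p x ∧ b) true

blocksNonempty : ∀ {n} → List (Subset n) → Bool
blocksNonempty = allB (λ s → ⌊ 1 ℕ.≤? ∣ s ∣ ⌋)

-- each element of [n] lies in exactly one block
-- (= blocks pairwise disjoint and their union is [n])
exactlyOneBlock : ∀ {n} → List (Subset n) → Bool
exactlyOneBlock {n} φ =
  allB (λ x → length (filter (λ s → x ∈? s) φ) ≡ᵇ 1) (toList (Vec.allFin n))

isSetComposition : ∀ {n} → List (Subset n) → Bool
isSetComposition φ = blocksNonempty φ ∧ exactlyOneBlock φ

isOdd : ∀ {n} → List (Subset n) → Bool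
isOdd = allB (λ s → ∣ s ∣ ℕ.% 2 ≡ᵇ 1)

setCompositions : (n ℓ : ℕ) → List (List (Subset n))
setCompositions n ℓ = filter (λ φ → isSetComposition φ Data.Bool.≟ true) (subsetLists n ℓ)
  where import Data.Bool

-- all set compositions of [n]  (a set composition of [n] has at most n blocks,
-- since its blocks are nonempty and disjoint)
allSetCompositions : (n : ℕ) → List (List (Subset n))
allSetCompositions n = concatMap (setCompositions n) (upTo (suc n))

oddSetCompositions : (n : ℕ) → List (List (Subset n))
oddSetCompositions n = filter (λ φ → isOdd φ Data.Bool.≟ true) (allSetCompositions n)
  where import Data.Bool

lhsSum : ℕ → ℚ
lhsSum n = sumℚ (map (λ φ → ℕtoℚ (2 ℕ.^ (n ∸ length φ)) * μ (suc (length φ)))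
                     (oddSetCompositions n))

module Submission where

-- The weighted count of weak set compositions of [n] into blocks with weights w₁, …, w_l on the block sizes is
-- n! [xⁿ] ∏ ŵᵢ(x), ŵ being the exponential generating function of w: putting the first element into a
-- block is the Leibniz rule. For odd blocks ŵ = sinh, and 2ⁿ⁻ˡ [xⁿ] sinhˡ x = [xⁿ] Yˡ with
-- Y = sinh x cosh x = ½ sinh 2x, so the left-hand side is n! [xⁿ] F(Y) for the Catalan series
-- F(t) = Σₘ (-1)ᵐ Cₘ t²ᵐ⁺¹ = (√(1 + 4t²) − 1)/2t. Instead of the square root we use that f = F(Y) solves
-- q f′ + f = 2Y with q = Y cosh 2x (by the Catalan recurrence and cosh² 2x = 1 + 4Y²), as does tanh x
-- (differentiate tanh x · 2 cosh² x = 2Y). Since q = x + O(x²) this equation determines f, so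
-- F(Y) = tanh x, and the odd coefficients of tanh are those of tan up to the sign (-1)^((n-1)/2).

open import Algebra.Bundles using (CommutativeRing; CommutativeMonoid)
import Algebra.Properties.CommutativeSemigroup as CommutativeSemigroupProperties
import Algebra.Properties.Group as GroupProperties
import Algebra.Solver.Ring
open import Algebra.Solver.Ring.AlmostCommutativeRing as ACR using (_-Raw-AlmostCommutative⟶_)
open import Data.Bool as Bool using (Bool; true; false; _∧_; if_then_else_)
open import Data.Bool.Properties using (∧-zeroʳ)
open import Data.Empty using (⊥-elim)
open import Data.Fin as Fin using (Fin)
open import Data.Fin.Subset using (Subset; inside; outside; ∣_∣)
open import Data.Fin.Subset.Properties using (_∈?_)
import Data.Integer as ℤ
import Data.Integer.Tactic.RingSolver as ℤ-Solver
open import Data.List as List using (List; []; _∷_; _++_; map; concatMap; filter; length; upTo; applyUpTo)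
open import Data.List.Properties using (length-replicate)
open import Data.Maybe as Maybe using (Maybe)
open import Data.Nat as ℕ using (ℕ; zero; suc; _∸_; _≤_; _<_; z≤n; s≤s; _^_; _!; _%_; _/_)
open import Data.Nat.Combinatorics using (_C_; k>n⇒nCk≡0; nCk+nC[k+1]≡[n+1]C[k+1]; nCk≡nC[n∸k])
open import Data.Nat.DivMod using (m*n%n≡0; [m+kn]%n≡m%n; m*n/n≡m)
open import Data.Nat.Induction using (<-rec)
import Data.Nat.Properties as ℕ
import Data.Nat.Tactic.RingSolver as ℕ-Solver
open import Data.Product using (_×_; _,_; proj₁)
open import Data.Rational as ℚ using (ℚ; _+_; _*_; -_; _-_; 0ℚ; 1ℚ; toℚᵘ)
open import Data.Rational.Properties
open import Data.Rational.Unnormalised as ℚᵘ using (mkℚᵘ; *≡*)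
import Data.Rational.Unnormalised.Properties as ℚᵘ
open import Data.Vec as Vec using ([]; _∷_)
open import Function using (_∘_; id)
open import Level using (0ℓ)
open import Relation.Binary.PropositionalEquality
import Relation.Binary.Reasoning.Setoid
open import Relation.Nullary using (Dec; does)
open import Relation.Nullary.Decidable using (dec⇒maybe; ⌊_⌋)
open import Tactic.RingSolver using (solve-∀)
open import Tactic.RingSolver.Core.AlmostCommutativeRing using (AlmostCommutativeRing; fromCommutativeRing)

open import Defs

open CommutativeSemigroupProperties (CommutativeMonoid.commutativeSemigroup *-1-commutativeMonoid)
  using (x∙yz≈y∙xz; interchange)
module ℚ-Group = GroupProperties +-0-group

ℚ-ring : AlmostCommutativeRing 0ℓ 0ℓ
ℚ-ring = fromCommutativeRing +-*-commutativeRing λ x → Maybe.map sym (dec⇒maybe (x ≟ 0ℚ))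

toℚᵘ-ℕtoℚ : ∀ n → toℚᵘ (ℕtoℚ n) ℚᵘ.≃ mkℚᵘ (ℤ.+ n) 0
toℚᵘ-ℕtoℚ n = toℚᵘ-fromℚᵘ (mkℚᵘ (ℤ.+ n) 0)

ℕtoℚ-homo-+ : ∀ m n → ℕtoℚ (m ℕ.+ n) ≡ ℕtoℚ m + ℕtoℚ n
ℕtoℚ-homo-+ m n = toℚᵘ-injective (begin
  toℚᵘ (ℕtoℚ (m ℕ.+ n))               ≈⟨ toℚᵘ-ℕtoℚ (m ℕ.+ n) ⟩
  mkℚᵘ (ℤ.+ m ℤ.+ ℤ.+ n) 0            ≈⟨ *≡* (distrib (ℤ.+ m) (ℤ.+ n)) ⟩
  mkℚᵘ (ℤ.+ m) 0 ℚᵘ.+ mkℚᵘ (ℤ.+ n) 0  ≈⟨ ℚᵘ.+-cong (toℚᵘ-ℕtoℚ m) (toℚᵘ-ℕtoℚ n) ⟨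
  toℚᵘ (ℕtoℚ m) ℚᵘ.+ toℚᵘ (ℕtoℚ n)    ≈⟨ toℚᵘ-homo-+ (ℕtoℚ m) (ℕtoℚ n) ⟨
  toℚᵘ (ℕtoℚ m + ℕtoℚ n)              ∎)
  where
  open ℚᵘ.≃-Reasoning
  distrib : ∀ a b → (a ℤ.+ b) ℤ.* ℤ.1ℤ ≡ (a ℤ.* ℤ.1ℤ ℤ.+ b ℤ.* ℤ.1ℤ) ℤ.* ℤ.1ℤ
  distrib = ℤ-Solver.solve-∀

1/n*n≡1 : ∀ n .{{_ : ℕ.NonZero n}} → (ℤ.+ 1 ℚ./ n) * ℕtoℚ n ≡ 1ℚ
1/n*n≡1 (suc d) = toℚᵘ-injective (begin
  toℚᵘ (ℤ.+ 1 ℚ./ suc d * ℕtoℚ (suc d))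
    ≈⟨ toℚᵘ-homo-* (ℤ.+ 1 ℚ./ suc d) (ℕtoℚ (suc d)) ⟩
  toℚᵘ (ℤ.+ 1 ℚ./ suc d) ℚᵘ.* toℚᵘ (ℕtoℚ (suc d))
    ≈⟨ ℚᵘ.*-cong (toℚᵘ-fromℚᵘ (mkℚᵘ (ℤ.+ 1) d)) (toℚᵘ-ℕtoℚ (suc d)) ⟩
  mkℚᵘ (ℤ.+ 1) d ℚᵘ.* mkℚᵘ (ℤ.+ suc d) 0
    ≈⟨ *≡* (cong (λ k → ℤ.+ suc k) (unit d)) ⟩
  ℚᵘ.1ℚᵘ ∎)
  where
  open ℚᵘ.≃-Reasoning
  unit : ∀ d → (d ℕ.+ 0 ℕ.* suc d) ℕ.* 1 ≡ d ℕ.* 1 ℕ.+ 0 ℕ.* suc (d ℕ.* 1)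
  unit = ℕ-Solver.solve-∀

ℕtoℚ-suc : ∀ n → ℕtoℚ (suc n) ≡ 1ℚ + ℕtoℚ n
ℕtoℚ-suc = ℕtoℚ-homo-+ 1

ℕtoℚ-homo-* : ∀ m n → ℕtoℚ (m ℕ.* n) ≡ ℕtoℚ m * ℕtoℚ n
ℕtoℚ-homo-* zero    n = sym (*-zeroˡ (ℕtoℚ n))
ℕtoℚ-homo-* (suc m) n = begin
  ℕtoℚ (n ℕ.+ m ℕ.* n)        ≡⟨ ℕtoℚ-homo-+ n (m ℕ.* n) ⟩
  ℕtoℚ n + ℕtoℚ (m ℕ.* n)     ≡⟨ cong (ℕtoℚ n +_) (ℕtoℚ-homo-* m n) ⟩
  ℕtoℚ n + ℕtoℚ m * ℕtoℚ n    ≡⟨ factor (ℕtoℚ m) (ℕtoℚ n) ⟩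
  (1ℚ + ℕtoℚ m) * ℕtoℚ n      ≡⟨ cong (_* ℕtoℚ n) (ℕtoℚ-suc m) ⟨
  ℕtoℚ (suc m) * ℕtoℚ n       ∎
  where
  open ≡-Reasoning
  factor : ∀ a b → b + a * b ≡ (1ℚ + a) * b
  factor = solve-∀ ℚ-ring


*-cancelˡ-invertible : ∀ {u c a b} → u * c ≡ 1ℚ → c * a ≡ c * b → a ≡ b
*-cancelˡ-invertible {u} {c} {a} {b} uc≡1 ca≡cb = begin
  a             ≡⟨ *-identityˡ a ⟨
  1ℚ * a        ≡⟨ cong (_* a) uc≡1 ⟨
  u * c * a     ≡⟨ *-assoc u c a ⟩
  u * (c * a)   ≡⟨ cong (u *_) ca≡cb ⟩
  u * (c * b)   ≡⟨ *-assoc u c b ⟨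
  u * c * b     ≡⟨ cong (_* b) uc≡1 ⟩
  1ℚ * b        ≡⟨ *-identityˡ b ⟩
  b             ∎
  where open ≡-Reasoning

ℕtoℚ-cancelˡ : ∀ n .{{_ : ℕ.NonZero n}} {a b} → ℕtoℚ n * a ≡ ℕtoℚ n * b → a ≡ b
ℕtoℚ-cancelˡ n = *-cancelˡ-invertible {u = ℤ.+ 1 ℚ./ n} {c = ℕtoℚ n} (1/n*n≡1 n)

invFact-inverse : ∀ k → invFact k * ℕtoℚ (k !) ≡ 1ℚ
invFact-inverse k = 1/n*n≡1 (k !) {{k ℕ.!≢0}}

invFact-suc : ∀ k → ℕtoℚ (suc k) * invFact (suc k) ≡ invFact k
invFact-suc k = ℕtoℚ-cancelˡ (k !) {{k ℕ.!≢0}} (begin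
  ℕtoℚ (k !) * (ℕtoℚ (suc k) * invFact (suc k))  ≡⟨ *-assoc (ℕtoℚ (k !)) _ _ ⟨
  ℕtoℚ (k !) * ℕtoℚ (suc k) * invFact (suc k)    ≡⟨ cong (_* invFact (suc k)) (*-comm (ℕtoℚ (k !)) _) ⟩
  ℕtoℚ (suc k) * ℕtoℚ (k !) * invFact (suc k)    ≡⟨ cong (_* invFact (suc k)) (ℕtoℚ-homo-* (suc k) (k !)) ⟨
  ℕtoℚ (suc k !) * invFact (suc k)               ≡⟨ *-comm _ (invFact (suc k)) ⟩
  invFact (suc k) * ℕtoℚ (suc k !)               ≡⟨ invFact-inverse (suc k) ⟩
  1ℚ                                             ≡⟨ invFact-inverse k ⟨
  invFact k * ℕtoℚ (k !)                         ≡⟨ *-comm (invFact k) _ ⟩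
  ℕtoℚ (k !) * invFact k                         ∎)
  where open ≡-Reasoning

signℚ-+ : ∀ a b → signℚ (a ℕ.+ b) ≡ signℚ a * signℚ b
signℚ-+ zero    b = sym (*-identityˡ (signℚ b))
signℚ-+ (suc a) b = trans (cong -_ (signℚ-+ a b)) (neg-distribˡ-* (signℚ a) (signℚ b))

signℚ-square : ∀ a → signℚ a * signℚ a ≡ 1ℚ
signℚ-square zero    = refl
signℚ-square (suc a) = trans (neg*neg (signℚ a)) (signℚ-square a)
  where
  neg*neg : ∀ s → - s * - s ≡ s * s
  neg*neg = solve-∀ ℚ-ring

Σ : ℕ → (ℕ → ℚ) → ℚ
Σ zero    f = 0ℚ
Σ (suc n) f = Σ n f + f n

Σ-cong : ∀ n {f g : ℕ → ℚ} → (∀ i → i < n → f i ≡ g i) → Σ n f ≡ Σ n g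
Σ-cong zero    f≡g = refl
Σ-cong (suc n) f≡g = cong₂ _+_ (Σ-cong n (λ i i<n → f≡g i (ℕ.m<n⇒m<1+n i<n))) (f≡g n (ℕ.n<1+n n))

Σ-cong′ : ∀ n {f g : ℕ → ℚ} → (∀ i → f i ≡ g i) → Σ n f ≡ Σ n g
Σ-cong′ n f≡g = Σ-cong n (λ i _ → f≡g i)

Σ-zero : ∀ n {f : ℕ → ℚ} → (∀ i → i < n → f i ≡ 0ℚ) → Σ n f ≡ 0ℚ
Σ-zero n {f} f≡0 = trans (Σ-cong n f≡0) (Σ-const0 n)
  where
  Σ-const0 : ∀ n → Σ n (λ _ → 0ℚ) ≡ 0ℚ
  Σ-const0 zero    = refl
  Σ-const0 (suc n) = cong (_+ 0ℚ) (Σ-const0 n)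

Σ-sucˡ : ∀ n f → Σ (suc n) f ≡ f 0 + Σ n (f ∘ suc)
Σ-sucˡ zero    f = trans (+-identityˡ (f 0)) (sym (+-identityʳ (f 0)))
Σ-sucˡ (suc n) f = trans (cong (_+ f (suc n)) (Σ-sucˡ n f)) (+-assoc (f 0) _ _)

sumℚ-map-applyUpTo : ∀ n (g : ℕ → ℕ) (f : ℕ → ℚ) → sumℚ (map f (applyUpTo g n)) ≡ Σ n (f ∘ g)
sumℚ-map-applyUpTo zero    g f = refl
sumℚ-map-applyUpTo (suc n) g f =
  trans (cong (f (g 0) +_) (sumℚ-map-applyUpTo n (g ∘ suc) f)) (sym (Σ-sucˡ n (f ∘ g)))

sumℚ-map-upTo : ∀ n (f : ℕ → ℚ) → sumℚ (map f (upTo n)) ≡ Σ n f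
sumℚ-map-upTo n = sumℚ-map-applyUpTo n id

Σ-distrib-+ : ∀ n (f g : ℕ → ℚ) → Σ n (λ i → f i + g i) ≡ Σ n f + Σ n g
Σ-distrib-+ zero    f g = refl
Σ-distrib-+ (suc n) f g = trans (cong (_+ (f n + g n)) (Σ-distrib-+ n f g)) (+-interchange (Σ n f) _ _ _)
  where
  +-interchange : ∀ a b c d → (a + b) + (c + d) ≡ (a + c) + (b + d)
  +-interchange = solve-∀ ℚ-ring

*-distribˡ-Σ : ∀ n a (f : ℕ → ℚ) → a * Σ n f ≡ Σ n (λ i → a * f i)
*-distribˡ-Σ zero    a f = *-zeroʳ a
*-distribˡ-Σ (suc n) a f = trans (*-distribˡ-+ a (Σ n f) (f n)) (cong (_+ a * f n) (*-distribˡ-Σ n a f))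

*-distribʳ-Σ : ∀ n a (f : ℕ → ℚ) → Σ n f * a ≡ Σ n (λ i → f i * a)
*-distribʳ-Σ n a f =
  trans (*-comm (Σ n f) a) (trans (*-distribˡ-Σ n a f) (Σ-cong′ n (λ i → *-comm a (f i))))

Σ-reverse : ∀ n (f : ℕ → ℚ) → Σ n f ≡ Σ n (λ i → f (n ∸ suc i))
Σ-reverse zero    f = refl
Σ-reverse (suc n) f = begin
  Σ n f + f n                        ≡⟨ cong (_+ f n) (Σ-reverse n f) ⟩
  Σ n (λ i → f (n ∸ suc i)) + f n    ≡⟨ +-comm _ (f n) ⟩
  f n + Σ n (λ i → f (n ∸ suc i))    ≡⟨ Σ-sucˡ n (λ i → f (suc n ∸ suc i)) ⟨
  Σ (suc n) (λ i → f (suc n ∸ suc i)) ∎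
  where open ≡-Reasoning

Σ-triangle : ∀ n (g : ℕ → ℕ → ℚ) →
  Σ (suc n) (λ i → Σ (suc i) (g i)) ≡ Σ (suc n) (λ j → Σ (suc (n ∸ j)) (λ k → g (j ℕ.+ k) j))
Σ-triangle zero    g = refl
Σ-triangle (suc n) g = begin
  R + (A + B)  ≡⟨ cong (_+ (A + B)) (Σ-triangle n g) ⟩
  R′ + (A + B) ≡⟨ +-assoc R′ A B ⟨
  (R′ + A) + B ≡⟨ cong₂ _+_ (trans (sym (Σ-distrib-+ (suc n) _ (g (suc n)))) (Σ-cong (suc n) extend-column)) last-column ⟩
  Σ (suc n) (λ j → Σ (suc (suc n ∸ j)) (λ k → g (j ℕ.+ k) j)) + Σ (suc (suc n ∸ suc n)) (λ k → g (suc n ℕ.+ k) (suc n)) ∎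
  where
  open ≡-Reasoning
  R  = Σ (suc n) (λ i → Σ (suc i) (g i))
  R′ = Σ (suc n) (λ j → Σ (suc (n ∸ j)) (λ k → g (j ℕ.+ k) j))
  A  = Σ (suc n) (g (suc n))
  B  = g (suc n) (suc n)
  extend-column : ∀ j → j < suc n →
    Σ (suc (n ∸ j)) (λ k → g (j ℕ.+ k) j) + g (suc n) j ≡ Σ (suc (suc n ∸ j)) (λ k → g (j ℕ.+ k) j)
  extend-column j (s≤s j≤n) rewrite ℕ.+-∸-assoc 1 j≤n =
    cong (Σ (suc (n ∸ j)) (λ k → g (j ℕ.+ k) j) +_)
      (cong (λ z → g z j) (sym (trans (ℕ.+-suc j (n ∸ j)) (cong suc (ℕ.m+[n∸m]≡n j≤n)))))
  last-column : B ≡ Σ (suc (suc n ∸ suc n)) (λ k → g (suc n ℕ.+ k) (suc n))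
  last-column rewrite ℕ.n∸n≡0 n | ℕ.+-identityʳ n = sym (+-identityˡ B)

-- Power series

infix 4 _≈S_
record _≈S_ (f g : Series) : Set where
  constructor mk≈
  field at : ∀ n → f n ≡ g n
open _≈S_ public

-S_ : Series → Series
(-S f) n = - f n

0S : Series
0S _ = 0ℚ

constS : ℚ → Series
constS a zero    = a
constS a (suc _) = 0ℚ

coeff-*S : ∀ f g k → (f *S g) k ≡ Σ (suc k) (λ i → f i * g (k ∸ i))
coeff-*S f g k = sumℚ-map-upTo (suc k) (λ i → f i * g (k ∸ i))

*S-cong : ∀ {f f′ g g′} → f ≈S f′ → g ≈S g′ → f *S g ≈S f′ *S g′
*S-cong {f} {f′} {g} {g′} f≈f′ g≈g′ = mk≈ λ k →
  trans (coeff-*S f g k)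
    (trans (Σ-cong′ (suc k) (λ i → cong₂ _*_ (at f≈f′ i) (at g≈g′ (k ∸ i)))) (sym (coeff-*S f′ g′ k)))

*S-comm : ∀ f g → f *S g ≈S g *S f
*S-comm f g = mk≈ λ k → begin
  (f *S g) k                                  ≡⟨ coeff-*S f g k ⟩
  Σ (suc k) (λ i → f i * g (k ∸ i))           ≡⟨ Σ-reverse (suc k) _ ⟩
  Σ (suc k) (λ i → f (k ∸ i) * g (k ∸ (k ∸ i))) ≡⟨ Σ-cong (suc k) (λ i i≤k → trans (*-comm (f (k ∸ i)) _)
                                                     (cong (λ j → g j * f (k ∸ i)) (ℕ.m∸[m∸n]≡n (ℕ.≤-pred i≤k)))) ⟩
  Σ (suc k) (λ i → g i * f (k ∸ i))           ≡⟨ coeff-*S g f k ⟨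
  (g *S f) k                                  ∎
  where open ≡-Reasoning

*S-assoc : ∀ f g h → (f *S g) *S h ≈S f *S (g *S h)
*S-assoc f g h = mk≈ λ n → begin
  ((f *S g) *S h) n
    ≡⟨ coeff-*S (f *S g) h n ⟩
  Σ (suc n) (λ i → (f *S g) i * h (n ∸ i))
    ≡⟨ Σ-cong′ (suc n) (λ i → trans (cong (_* h (n ∸ i)) (coeff-*S f g i)) (*-distribʳ-Σ (suc i) (h (n ∸ i)) _)) ⟩
  Σ (suc n) (λ i → Σ (suc i) (λ j → f j * g (i ∸ j) * h (n ∸ i)))
    ≡⟨ Σ-triangle n (λ i j → f j * g (i ∸ j) * h (n ∸ i)) ⟩
  Σ (suc n) (λ j → Σ (suc (n ∸ j)) (λ k → f j * g ((j ℕ.+ k) ∸ j) * h (n ∸ (j ℕ.+ k))))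
    ≡⟨ Σ-cong′ (suc n) (inner n) ⟩
  Σ (suc n) (λ j → f j * (g *S h) (n ∸ j))
    ≡⟨ coeff-*S f (g *S h) n ⟨
  (f *S (g *S h)) n ∎
  where
  open ≡-Reasoning
  inner : ∀ n j → Σ (suc (n ∸ j)) (λ k → f j * g ((j ℕ.+ k) ∸ j) * h (n ∸ (j ℕ.+ k))) ≡ f j * (g *S h) (n ∸ j)
  inner n j = begin
    Σ (suc (n ∸ j)) (λ k → f j * g ((j ℕ.+ k) ∸ j) * h (n ∸ (j ℕ.+ k)))
      ≡⟨ Σ-cong′ (suc (n ∸ j)) (λ k → trans (*-assoc (f j) _ _)
           (cong₂ (λ a b → f j * (g a * h b)) (ℕ.m+n∸m≡n j k) (sym (ℕ.∸-+-assoc n j k)))) ⟩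
    Σ (suc (n ∸ j)) (λ k → f j * (g k * h (n ∸ j ∸ k))) ≡⟨ *-distribˡ-Σ (suc (n ∸ j)) (f j) _ ⟨
    f j * Σ (suc (n ∸ j)) (λ k → g k * h (n ∸ j ∸ k))  ≡⟨ cong (f j *_) (coeff-*S g h (n ∸ j)) ⟨
    f j * (g *S h) (n ∸ j)                              ∎

*S-distribˡ-+S : ∀ f g h → f *S (g +S h) ≈S (f *S g) +S (f *S h)
*S-distribˡ-+S f g h = mk≈ λ n → begin
  (f *S (g +S h)) n                                   ≡⟨ coeff-*S f (g +S h) n ⟩
  Σ (suc n) (λ i → f i * (g (n ∸ i) + h (n ∸ i)))     ≡⟨ Σ-cong′ (suc n) (λ i → *-distribˡ-+ (f i) _ _) ⟩
  Σ (suc n) (λ i → f i * g (n ∸ i) + f i * h (n ∸ i)) ≡⟨ Σ-distrib-+ (suc n) _ _ ⟩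
  Σ (suc n) (λ i → f i * g (n ∸ i)) + Σ (suc n) (λ i → f i * h (n ∸ i))
                                                      ≡⟨ cong₂ _+_ (coeff-*S f g n) (coeff-*S f h n) ⟨
  ((f *S g) +S (f *S h)) n                            ∎
  where open ≡-Reasoning

*S-distribʳ-+S : ∀ f g h → (g +S h) *S f ≈S (g *S f) +S (h *S f)
*S-distribʳ-+S f g h = mk≈ λ n →
  trans (at (*S-comm (g +S h) f) n)
    (trans (at (*S-distribˡ-+S f g h) n) (cong₂ _+_ (at (*S-comm f g) n) (at (*S-comm f h) n)))

coeff-*S-constant : ∀ c f n → (∀ i → c (suc i) ≡ 0ℚ) → (c *S f) n ≡ c 0 * f n
coeff-*S-constant c f n c≡0 = begin
  (c *S f) n                                  ≡⟨ coeff-*S c f n ⟩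
  Σ (suc n) (λ i → c i * f (n ∸ i))           ≡⟨ Σ-sucˡ n _ ⟩
  c 0 * f n + Σ n (λ i → c (suc i) * f (n ∸ suc i))
                                              ≡⟨ cong (c 0 * f n +_) (Σ-zero n (λ i _ → trans (cong (_* f (n ∸ suc i)) (c≡0 i)) (*-zeroˡ (f (n ∸ suc i))))) ⟩
  c 0 * f n + 0ℚ                              ≡⟨ +-identityʳ _ ⟩
  c 0 * f n                                   ∎
  where open ≡-Reasoning

coeff-constS-*S : ∀ a f n → (constS a *S f) n ≡ a * f n
coeff-constS-*S a f n = coeff-*S-constant (constS a) f n (λ _ → refl)

*S-identityˡ : ∀ f → oneS *S f ≈S f
*S-identityˡ f = mk≈ λ n → trans (coeff-*S-constant oneS f n (λ _ → refl)) (*-identityˡ (f n))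

*S-identityʳ : ∀ f → f *S oneS ≈S f
*S-identityʳ f = mk≈ λ n → trans (at (*S-comm f oneS) n) (at (*S-identityˡ f) n)

SeriesRing : CommutativeRing 0ℓ 0ℓ
SeriesRing = record
  { Carrier = Series
  ; _≈_ = _≈S_
  ; _+_ = _+S_
  ; _*_ = _*S_
  ; -_ = -S_
  ; 0# = 0S
  ; 1# = oneS
  ; isCommutativeRing = record
    { isRing = record
      { +-isAbelianGroup = record
        { isGroup = record
          { isMonoid = record
            { isSemigroup = record
              { isMagma = record
                { isEquivalence = record
                  { refl = mk≈ λ _ → refl
                  ; sym = λ p → mk≈ λ n → sym (at p n)
                  ; trans = λ p q → mk≈ λ n → trans (at p n) (at q n) }
                ; ∙-cong = λ p q → mk≈ λ n → cong₂ _+_ (at p n) (at q n) }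
              ; assoc = λ f g h → mk≈ λ n → +-assoc (f n) (g n) (h n) }
            ; identity = (λ f → mk≈ λ n → +-identityˡ (f n)) , (λ f → mk≈ λ n → +-identityʳ (f n)) }
          ; inverse = (λ f → mk≈ λ n → +-inverseˡ (f n)) , (λ f → mk≈ λ n → +-inverseʳ (f n))
          ; ⁻¹-cong = λ p → mk≈ λ n → cong -_ (at p n) }
        ; comm = λ f g → mk≈ λ n → +-comm (f n) (g n) }
      ; *-cong = *S-cong
      ; *-assoc = *S-assoc
      ; *-identity = *S-identityˡ , *S-identityʳ
      ; distrib = *S-distribˡ-+S , *S-distribʳ-+S }
    ; *-comm = *S-comm } }

module SR = CommutativeRing SeriesRing

constS-homomorphism : +-*-rawRing -Raw-AlmostCommutative⟶ ACR.fromCommutativeRing SeriesRing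
constS-homomorphism = record
  { ⟦_⟧    = constS
  ; +-homo = λ a b → mk≈ λ { zero → refl ; (suc n) → refl }
  ; *-homo = λ a b → mk≈ λ n → trans (*-homo a b n) (sym (coeff-constS-*S a (constS b) n))
  ; -‿homo = λ a → mk≈ λ { zero → refl ; (suc n) → refl }
  ; 0-homo = mk≈ λ { zero → refl ; (suc n) → refl }
  ; 1-homo = mk≈ λ { zero → refl ; (suc n) → refl } }
  where
  *-homo : ∀ a b n → constS (a * b) n ≡ a * constS b n
  *-homo a b zero    = refl
  *-homo a b (suc n) = sym (*-zeroʳ a)

constS-≟ : ∀ a b → Maybe (constS a ≈S constS b)
constS-≟ a b = Maybe.map (λ { refl → SR.refl }) (dec⇒maybe (a ≟ b))

-- The solver evaluates `con a` to `constS a`, so goals must be phrased with `constS 1ℚ` rather than `oneS`.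
module SeriesSolver = Algebra.Solver.Ring +-*-rawRing (ACR.fromCommutativeRing SeriesRing) constS-homomorphism constS-≟
open SeriesSolver using (solve; _:=_; _:+_; _:*_; :-_; _:-_; con)
module ≈S-Reasoning = Relation.Binary.Reasoning.Setoid SR.setoid
open GroupProperties SR.+-group using (x∙y⁻¹≈ε⇒x≈y; x≈y⇒x∙y⁻¹≈ε)

-- Defs gives _+S_ and _*S_ no fixity.
infixl 6 _⊕_ _⊖_
infixl 7 _⊗_

_⊕_ _⊗_ _⊖_ : Series → Series → Series
_⊕_ = _+S_
_⊗_ = _*S_
f ⊖ g = f ⊕ -S g

constS-cong : ∀ {a b} → a ≡ b → constS a ≈S constS b
constS-cong refl = SR.refl

constS-homo-+ : ∀ a b → constS (a + b) ≈S constS a ⊕ constS b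
constS-homo-+ = _-Raw-AlmostCommutative⟶_.+-homo constS-homomorphism

constS-homo-* : ∀ a b → constS (a * b) ≈S constS a ⊗ constS b
constS-homo-* = _-Raw-AlmostCommutative⟶_.*-homo constS-homomorphism

constS-0 : constS 0ℚ ≈S 0S
constS-0 = mk≈ λ { zero → refl ; (suc n) → refl }

constS-1 : constS 1ℚ ≈S oneS
constS-1 = mk≈ λ { zero → refl ; (suc n) → refl }

infixr 8 _^S_
_^S_ : Series → ℕ → Series
f ^S zero  = oneS
f ^S suc l = f ⊗ f ^S l

^S-cong : ∀ {f g} → f ≈S g → ∀ l → f ^S l ≈S g ^S l
^S-cong f≈g zero    = SR.refl
^S-cong f≈g (suc l) = SR.*-cong f≈g (^S-cong f≈g l)

coeff-*S-low : ∀ f g n → (∀ k → k ≤ n → g k ≡ 0ℚ) → (f ⊗ g) n ≡ 0ℚ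
coeff-*S-low f g n g≡0 = trans (coeff-*S f g n)
  (Σ-zero (suc n) (λ i _ → trans (cong (f i *_) (g≡0 (n ∸ i) (ℕ.m∸n≤m n i))) (*-zeroʳ (f i))))

^S-low : ∀ f → f 0 ≡ 0ℚ → ∀ l n → n < l → (f ^S l) n ≡ 0ℚ
^S-low f f₀≡0 (suc l) n (s≤s n≤l) = trans (coeff-*S f (f ^S l) n) (Σ-zero (suc n) term≡0)
  where
  term≡0 : ∀ i → i < suc n → f i * (f ^S l) (n ∸ i) ≡ 0ℚ
  term≡0 zero    _ = trans (cong (_* (f ^S l) n) f₀≡0) (*-zeroˡ ((f ^S l) n))
  term≡0 (suc j) (s≤s j<n) = trans (cong (f (suc j) *_)
    (^S-low f f₀≡0 l (n ∸ suc j) (ℕ.≤-trans (ℕ.∸-monoʳ-< {n} {suc j} {0} (s≤s z≤n) j<n) n≤l))) (*-zeroʳ (f (suc j)))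

∂ : Series → Series
∂ f n = ℕtoℚ (suc n) * f (suc n)

∂-cong : ∀ {f g} → f ≈S g → ∂ f ≈S ∂ g
∂-cong f≈g = mk≈ λ n → cong (ℕtoℚ (suc n) *_) (at f≈g (suc n))

∂-homo-+ : ∀ f g → ∂ (f ⊕ g) ≈S ∂ f ⊕ ∂ g
∂-homo-+ f g = mk≈ λ n → *-distribˡ-+ (ℕtoℚ (suc n)) (f (suc n)) (g (suc n))

∂-homo-⊖ : ∀ f g → ∂ (f ⊖ g) ≈S ∂ f ⊖ ∂ g
∂-homo-⊖ f g = mk≈ λ n → trans (at (∂-homo-+ f (-S g)) n)
  (cong (∂ f n +_) (sym (neg-distribʳ-* (ℕtoℚ (suc n)) (g (suc n)))))

∂-constS : ∀ a → ∂ (constS a) ≈S 0S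
∂-constS a = mk≈ λ n → *-zeroʳ (ℕtoℚ (suc n))

∂-oneS : ∂ oneS ≈S 0S
∂-oneS = mk≈ λ n → *-zeroʳ (ℕtoℚ (suc n))

coeff-∂*S : ∀ f g n → (∂ f ⊗ g) n ≡ Σ (suc (suc n)) (λ i → ℕtoℚ i * (f i * g (suc n ∸ i)))
coeff-∂*S f g n = sym (begin
  Σ (suc (suc n)) (λ i → ℕtoℚ i * (f i * g (suc n ∸ i)))
    ≡⟨ Σ-sucˡ (suc n) _ ⟩
  0ℚ * (f 0 * g (suc n)) + Σ (suc n) (λ i → ℕtoℚ (suc i) * (f (suc i) * g (n ∸ i)))
    ≡⟨ cong (_+ Σ (suc n) (λ i → ℕtoℚ (suc i) * (f (suc i) * g (n ∸ i)))) (*-zeroˡ (f 0 * g (suc n))) ⟩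
  0ℚ + Σ (suc n) (λ i → ℕtoℚ (suc i) * (f (suc i) * g (n ∸ i)))
    ≡⟨ +-identityˡ _ ⟩
  Σ (suc n) (λ i → ℕtoℚ (suc i) * (f (suc i) * g (n ∸ i)))
    ≡⟨ Σ-cong′ (suc n) (λ i → sym (*-assoc (ℕtoℚ (suc i)) (f (suc i)) (g (n ∸ i)))) ⟩
  Σ (suc n) (λ i → ∂ f i * g (n ∸ i))
    ≡⟨ coeff-*S (∂ f) g n ⟨
  (∂ f ⊗ g) n ∎)
  where open ≡-Reasoning

coeff-*S∂ : ∀ f g n → (f ⊗ ∂ g) n ≡ Σ (suc (suc n)) (λ i → ℕtoℚ (suc n ∸ i) * (f i * g (suc n ∸ i)))
coeff-*S∂ f g n = sym (begin
  S + ℕtoℚ (n ∸ n) * (f (suc n) * g (n ∸ n))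
    ≡⟨ cong (λ m → S + ℕtoℚ m * (f (suc n) * g m)) (ℕ.n∸n≡0 n) ⟩
  S + 0ℚ * (f (suc n) * g 0)
    ≡⟨ cong (S +_) (*-zeroˡ (f (suc n) * g 0)) ⟩
  S + 0ℚ
    ≡⟨ +-identityʳ S ⟩
  S
    ≡⟨ Σ-cong (suc n) move-factor ⟩
  Σ (suc n) (λ i → f i * ∂ g (n ∸ i))
    ≡⟨ coeff-*S f (∂ g) n ⟨
  (f ⊗ ∂ g) n ∎)
  where
  open ≡-Reasoning
  S = Σ (suc n) (λ i → ℕtoℚ (suc n ∸ i) * (f i * g (suc n ∸ i)))
  move-factor : ∀ i → i < suc n → ℕtoℚ (suc n ∸ i) * (f i * g (suc n ∸ i)) ≡ f i * ∂ g (n ∸ i)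
  move-factor i (s≤s i≤n) rewrite ℕ.+-∸-assoc 1 i≤n = x∙yz≈y∙xz (ℕtoℚ (suc (n ∸ i))) (f i) _

∂-leibniz : ∀ f g → ∂ (f ⊗ g) ≈S ∂ f ⊗ g ⊕ f ⊗ ∂ g
∂-leibniz f g = mk≈ λ n → begin
  ℕtoℚ (suc n) * (f ⊗ g) (suc n)
    ≡⟨ cong (ℕtoℚ (suc n) *_) (coeff-*S f g (suc n)) ⟩
  ℕtoℚ (suc n) * Σ (suc (suc n)) (A n)
    ≡⟨ *-distribˡ-Σ (suc (suc n)) (ℕtoℚ (suc n)) (A n) ⟩
  Σ (suc (suc n)) (λ i → ℕtoℚ (suc n) * A n i)
    ≡⟨ Σ-cong (suc (suc n)) (split n) ⟩
  Σ (suc (suc n)) (λ i → ℕtoℚ i * A n i + ℕtoℚ (suc n ∸ i) * A n i)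
    ≡⟨ Σ-distrib-+ (suc (suc n)) _ _ ⟩
  Σ (suc (suc n)) (λ i → ℕtoℚ i * A n i) + Σ (suc (suc n)) (λ i → ℕtoℚ (suc n ∸ i) * A n i)
    ≡⟨ cong₂ _+_ (coeff-∂*S f g n) (coeff-*S∂ f g n) ⟨
  (∂ f ⊗ g) n + (f ⊗ ∂ g) n ∎
  where
  open ≡-Reasoning
  A : ℕ → ℕ → ℚ
  A n i = f i * g (suc n ∸ i)
  split : ∀ n i → i < suc (suc n) → ℕtoℚ (suc n) * A n i ≡ ℕtoℚ i * A n i + ℕtoℚ (suc n ∸ i) * A n i
  split n i (s≤s i≤1+n) = trans (cong (λ m → ℕtoℚ m * A n i) (sym (ℕ.m+[n∸m]≡n i≤1+n)))
    (trans (cong (_* A n i) (ℕtoℚ-homo-+ i (suc n ∸ i))) (*-distribʳ-+ (A n i) (ℕtoℚ i) _))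

∂-constS-⊗ : ∀ c f → ∂ (constS c ⊗ f) ≈S constS c ⊗ ∂ f
∂-constS-⊗ c f = begin
  ∂ (constS c ⊗ f)                        ≈⟨ ∂-leibniz (constS c) f ⟩
  ∂ (constS c) ⊗ f ⊕ constS c ⊗ ∂ f       ≈⟨ SR.+-congʳ {constS c ⊗ ∂ f} (SR.*-congʳ {f} (∂-constS c)) ⟩
  0S ⊗ f ⊕ constS c ⊗ ∂ f                 ≈⟨ SR.+-congʳ {constS c ⊗ ∂ f} (SR.zeroˡ f) ⟩
  0S ⊕ constS c ⊗ ∂ f                     ≈⟨ SR.+-identityˡ _ ⟩
  constS c ⊗ ∂ f                          ∎
  where open ≈S-Reasoning

∂≈0⇒≈0 : ∀ f → ∂ f ≈S 0S → f 0 ≡ 0ℚ → f ≈S 0S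
∂≈0⇒≈0 f ∂f≈0 f₀≡0 = mk≈ λ
  { zero    → f₀≡0
  ; (suc n) → ℕtoℚ-cancelˡ (suc n) (trans (at ∂f≈0 n) (sym (*-zeroʳ (ℕtoℚ (suc n))))) }

vanishing-by-<-induction : (r : Series) (K : ℕ) →
  (∀ k → k ≤ K → (∀ j → j < k → r j ≡ 0ℚ) → r k ≡ 0ℚ) → ∀ k → k ≤ K → r k ≡ 0ℚ
vanishing-by-<-induction r K step = <-rec (λ k → k ≤ K → r k ≡ 0ℚ)
  λ k ih k≤K → step k k≤K (λ j j<k → ih j<k (ℕ.≤-trans (ℕ.<⇒≤ j<k) k≤K))

coeff-*S-top : ∀ f g k → (∀ j → j < k → f j ≡ 0ℚ) → (f ⊗ g) k ≡ f k * g 0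
coeff-*S-top f g k below = begin
  (f ⊗ g) k                                          ≡⟨ coeff-*S f g k ⟩
  Σ k (λ i → f i * g (k ∸ i)) + f k * g (k ∸ k)      ≡⟨ cong₂ _+_ (Σ-zero k lower) (cong (λ j → f k * g j) (ℕ.n∸n≡0 k)) ⟩
  0ℚ + f k * g 0                                     ≡⟨ +-identityˡ _ ⟩
  f k * g 0                                          ∎
  where
  open ≡-Reasoning
  lower : ∀ i → i < k → f i * g (k ∸ i) ≡ 0ℚ
  lower i i<k = trans (cong (_* g (k ∸ i)) (below i i<k)) (*-zeroˡ (g (k ∸ i)))

*S≈0⇒≈0 : ∀ a c r → a * c 0 ≡ 1ℚ → c ⊗ r ≈S 0S → r ≈S 0S
*S≈0⇒≈0 a c r ac₀≡1 cr≈0 = mk≈ λ n → vanishing-by-<-induction r n (λ k _ → r≡0 k) n ℕ.≤-refl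
  where
  r≡0 : ∀ k → (∀ j → j < k → r j ≡ 0ℚ) → r k ≡ 0ℚ
  r≡0 k below = *-cancelˡ-invertible {u = a} {c = c 0} ac₀≡1 (begin
    c 0 * r k    ≡⟨ *-comm (c 0) (r k) ⟩
    r k * c 0    ≡⟨ coeff-*S-top r c k below ⟨
    (r ⊗ c) k    ≡⟨ at (*S-comm r c) k ⟩
    (c ⊗ r) k    ≡⟨ at cr≈0 k ⟩
    0ℚ           ≡⟨ *-zeroʳ (c 0) ⟨
    c 0 * 0ℚ     ∎)
    where open ≡-Reasoning

-- Since q₀ = 0 and q₁ = 1, the k-th coefficient of q ∂r + r is (k+1) r_k plus terms in lower coefficients of r.
q∂r+r-uniqueness : ∀ q → q 0 ≡ 0ℚ → q 1 ≡ 1ℚ → ∀ r K →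
  (∀ k → k ≤ K → (q ⊗ ∂ r ⊕ r) k ≡ 0ℚ) → ∀ k → k ≤ K → r k ≡ 0ℚ
q∂r+r-uniqueness q q₀≡0 q₁≡1 r K q∂r+r≡0 = vanishing-by-<-induction r K λ k k≤K below →
  ℕtoℚ-cancelˡ (suc k) (trans (sym (leading k below)) (trans (q∂r+r≡0 k k≤K) (sym (*-zeroʳ (ℕtoℚ (suc k))))))
  where
  open ≡-Reasoning
  collect₀ : ∀ b x → (0ℚ * b + 0ℚ) + x ≡ 1ℚ * x
  collect₀ = solve-∀ ℚ-ring
  collect : ∀ a x b → (0ℚ + a * x * 1ℚ) + b * 0ℚ + x ≡ (1ℚ + a) * x
  collect = solve-∀ ℚ-ring
  leading : ∀ k → (∀ j → j < k → r j ≡ 0ℚ) → (q ⊗ ∂ r ⊕ r) k ≡ ℕtoℚ (suc k) * r k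
  leading zero _ = begin
    (q 0 * ∂ r 0 + 0ℚ) + r 0   ≡⟨ cong (λ x → (x * ∂ r 0 + 0ℚ) + r 0) q₀≡0 ⟩
    (0ℚ * ∂ r 0 + 0ℚ) + r 0    ≡⟨ collect₀ (∂ r 0) (r 0) ⟩
    1ℚ * r 0                   ∎
  leading (suc m) below = begin
    (q ⊗ ∂ r) (suc m) + r (suc m)
      ≡⟨ cong (_+ r (suc m)) (at (*S-comm q (∂ r)) (suc m)) ⟩
    (∂ r ⊗ q) (suc m) + r (suc m)
      ≡⟨ cong (_+ r (suc m)) (coeff-*S (∂ r) q (suc m)) ⟩
    (Σ m (λ i → ∂ r i * q (suc m ∸ i)) + ∂ r m * q (suc m ∸ m)) + ∂ r (suc m) * q (m ∸ m) + r (suc m)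
      ≡⟨ cong₂ (λ x y → (x + ∂ r m * q y) + ∂ r (suc m) * q (m ∸ m) + r (suc m))
               (Σ-zero m (λ i i<m → ∂r-low i (s≤s i<m))) (ℕ.m+n∸n≡m 1 m) ⟩
    (0ℚ + ∂ r m * q 1) + ∂ r (suc m) * q (m ∸ m) + r (suc m)
      ≡⟨ cong₂ (λ x y → (0ℚ + ∂ r m * x) + ∂ r (suc m) * q y + r (suc m)) q₁≡1 (ℕ.n∸n≡0 m) ⟩
    (0ℚ + ∂ r m * 1ℚ) + ∂ r (suc m) * q 0 + r (suc m)
      ≡⟨ cong (λ x → (0ℚ + ∂ r m * 1ℚ) + ∂ r (suc m) * x + r (suc m)) q₀≡0 ⟩
    (0ℚ + ℕtoℚ (suc m) * r (suc m) * 1ℚ) + ∂ r (suc m) * 0ℚ + r (suc m)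
      ≡⟨ collect (ℕtoℚ (suc m)) (r (suc m)) (∂ r (suc m)) ⟩
    (1ℚ + ℕtoℚ (suc m)) * r (suc m)
      ≡⟨ cong (_* r (suc m)) (ℕtoℚ-suc (suc m)) ⟨
    ℕtoℚ (suc (suc m)) * r (suc m) ∎
    where
    ∂r-low : ∀ i → suc i < suc m → ∂ r i * q (suc m ∸ i) ≡ 0ℚ
    ∂r-low i i+1<m+1 = trans (cong (λ x → ℕtoℚ (suc i) * x * q (suc m ∸ i)) (below (suc i) i+1<m+1))
      (trans (cong (_* q (suc m ∸ i)) (*-zeroʳ (ℕtoℚ (suc i)))) (*-zeroˡ (q (suc m ∸ i))))

∂-system-uniqueness : ∀ a b (c d : ℚ) → ∂ a ≈S constS c ⊗ b → ∂ b ≈S constS d ⊗ a →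
  a 0 ≡ 0ℚ → b 0 ≡ 0ℚ → ∀ n → a n ≡ 0ℚ × b n ≡ 0ℚ
∂-system-uniqueness a b c d ∂a≈cb ∂b≈da a₀≡0 b₀≡0 zero    = a₀≡0 , b₀≡0
∂-system-uniqueness a b c d ∂a≈cb ∂b≈da a₀≡0 b₀≡0 (suc n) =
  let aₙ≡0 , bₙ≡0 = ∂-system-uniqueness a b c d ∂a≈cb ∂b≈da a₀≡0 b₀≡0 n
  in next a b c ∂a≈cb bₙ≡0 , next b a d ∂b≈da aₙ≡0
  where
  next : ∀ f g e → ∂ f ≈S constS e ⊗ g → g n ≡ 0ℚ → f (suc n) ≡ 0ℚ
  next f g e ∂f≈eg gₙ≡0 = ℕtoℚ-cancelˡ (suc n) (begin
    ℕtoℚ (suc n) * f (suc n)  ≡⟨ at ∂f≈eg n ⟩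
    (constS e ⊗ g) n          ≡⟨ coeff-constS-*S e g n ⟩
    e * g n                   ≡⟨ cong (e *_) gₙ≡0 ⟩
    e * 0ℚ                    ≡⟨ *-zeroʳ e ⟩
    0ℚ                        ≡⟨ *-zeroʳ (ℕtoℚ (suc n)) ⟨
    ℕtoℚ (suc n) * 0ℚ         ∎)
    where open ≡-Reasoning

2ℚ 4ℚ : ℚ
2ℚ = ℕtoℚ 2
4ℚ = ℕtoℚ 4

dilate₂ : Series → Series
dilate₂ f n = ℕtoℚ (2 ^ n) * f n

dilate₂-cong : ∀ {f g} → f ≈S g → dilate₂ f ≈S dilate₂ g
dilate₂-cong f≈g = mk≈ λ n → cong (ℕtoℚ (2 ^ n) *_) (at f≈g n)

dilate₂-homo-* : ∀ f g → dilate₂ (f ⊗ g) ≈S dilate₂ f ⊗ dilate₂ g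
dilate₂-homo-* f g = mk≈ λ n → begin
  ℕtoℚ (2 ^ n) * (f ⊗ g) n                          ≡⟨ cong (ℕtoℚ (2 ^ n) *_) (coeff-*S f g n) ⟩
  ℕtoℚ (2 ^ n) * Σ (suc n) (λ i → f i * g (n ∸ i))  ≡⟨ *-distribˡ-Σ (suc n) (ℕtoℚ (2 ^ n)) _ ⟩
  Σ (suc n) (λ i → ℕtoℚ (2 ^ n) * (f i * g (n ∸ i))) ≡⟨ Σ-cong (suc n) (split n) ⟩
  Σ (suc n) (λ i → dilate₂ f i * dilate₂ g (n ∸ i))  ≡⟨ coeff-*S (dilate₂ f) (dilate₂ g) n ⟨
  (dilate₂ f ⊗ dilate₂ g) n                          ∎
  where
  open ≡-Reasoning
  split : ∀ n i → i < suc n → ℕtoℚ (2 ^ n) * (f i * g (n ∸ i)) ≡ dilate₂ f i * dilate₂ g (n ∸ i)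
  split n i (s≤s i≤n) = begin
    ℕtoℚ (2 ^ n) * (f i * g (n ∸ i))                  ≡⟨ cong (λ m → ℕtoℚ (2 ^ m) * (f i * g (n ∸ i))) (ℕ.m+[n∸m]≡n i≤n) ⟨
    ℕtoℚ (2 ^ (i ℕ.+ (n ∸ i))) * (f i * g (n ∸ i))    ≡⟨ cong (λ m → ℕtoℚ m * (f i * g (n ∸ i))) (ℕ.^-distribˡ-+-* 2 i (n ∸ i)) ⟩
    ℕtoℚ (2 ^ i ℕ.* 2 ^ (n ∸ i)) * (f i * g (n ∸ i))  ≡⟨ cong (_* (f i * g (n ∸ i))) (ℕtoℚ-homo-* (2 ^ i) (2 ^ (n ∸ i))) ⟩
    ℕtoℚ (2 ^ i) * ℕtoℚ (2 ^ (n ∸ i)) * (f i * g (n ∸ i)) ≡⟨ interchange (ℕtoℚ (2 ^ i)) _ _ _ ⟩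
    dilate₂ f i * dilate₂ g (n ∸ i)                   ∎

dilate₂-^S : ∀ f l → dilate₂ (f ^S l) ≈S dilate₂ f ^S l
dilate₂-^S f zero    = mk≈ λ { zero → refl ; (suc n) → *-zeroʳ (ℕtoℚ (2 ^ suc n)) }
dilate₂-^S f (suc l) = SR.trans (dilate₂-homo-* f (f ^S l)) (SR.*-congˡ {dilate₂ f} (dilate₂-^S f l))

∂-dilate₂ : ∀ f → ∂ (dilate₂ f) ≈S constS 2ℚ ⊗ dilate₂ (∂ f)
∂-dilate₂ f = mk≈ λ n → sym (begin
  (constS 2ℚ ⊗ dilate₂ (∂ f)) n                         ≡⟨ coeff-constS-*S 2ℚ (dilate₂ (∂ f)) n ⟩
  2ℚ * (ℕtoℚ (2 ^ n) * (ℕtoℚ (suc n) * f (suc n)))      ≡⟨ rearrange 2ℚ (ℕtoℚ (2 ^ n)) (ℕtoℚ (suc n)) (f (suc n)) ⟩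
  ℕtoℚ (suc n) * ((2ℚ * ℕtoℚ (2 ^ n)) * f (suc n))      ≡⟨ cong (λ x → ℕtoℚ (suc n) * (x * f (suc n))) (ℕtoℚ-homo-* 2 (2 ^ n)) ⟨
  ∂ (dilate₂ f) n                                       ∎)
  where
  open ≡-Reasoning
  rearrange : ∀ a b c d → a * (b * (c * d)) ≡ c * ((a * b) * d)
  rearrange = solve-∀ ℚ-ring

-- Hyperbolic functions

data Parity : ℕ → Set where
  even : ∀ m → Parity (m ℕ.* 2)
  odd  : ∀ m → Parity (suc (m ℕ.* 2))

parity : ∀ n → Parity n
parity zero = even 0
parity (suc n) with parity n
... | even m = odd m
... | odd m  = even (suc m)

isEven-even : ∀ m → isEven (m ℕ.* 2) ≡ true
isEven-even m = cong (ℕ._≡ᵇ 0) (m*n%n≡0 m 2)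

isEven-odd : ∀ m → isEven (suc (m ℕ.* 2)) ≡ false
isEven-odd m = cong (ℕ._≡ᵇ 0) ([m+kn]%n≡m%n 1 m 2)

sinhS coshS : Series
sinhS k = if isEven k then 0ℚ else invFact k
coshS k = if isEven k then invFact k else 0ℚ

sinhS-even : ∀ m → sinhS (m ℕ.* 2) ≡ 0ℚ
sinhS-even m = cong (if_then 0ℚ else invFact (m ℕ.* 2)) (isEven-even m)

sinhS-odd : ∀ m → sinhS (suc (m ℕ.* 2)) ≡ invFact (suc (m ℕ.* 2))
sinhS-odd m = cong (if_then 0ℚ else invFact (suc (m ℕ.* 2))) (isEven-odd m)

coshS-even : ∀ m → coshS (m ℕ.* 2) ≡ invFact (m ℕ.* 2)
coshS-even m = cong (if_then invFact (m ℕ.* 2) else 0ℚ) (isEven-even m)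

coshS-odd : ∀ m → coshS (suc (m ℕ.* 2)) ≡ 0ℚ
coshS-odd m = cong (if_then invFact (suc (m ℕ.* 2)) else 0ℚ) (isEven-odd m)

∂-sinhS : ∂ sinhS ≈S coshS
∂-sinhS = mk≈ λ n → coeff (parity n)
  where
  coeff : ∀ {n} → Parity n → ∂ sinhS n ≡ coshS n
  coeff (even m) = trans (cong (ℕtoℚ (suc (m ℕ.* 2)) *_) (sinhS-odd m))
    (trans (invFact-suc (m ℕ.* 2)) (sym (coshS-even m)))
  coeff (odd m)  = trans (cong (ℕtoℚ (suc (suc (m ℕ.* 2))) *_) (sinhS-even (suc m)))
    (trans (*-zeroʳ (ℕtoℚ (suc (suc (m ℕ.* 2))))) (sym (coshS-odd m)))

∂-coshS : ∂ coshS ≈S sinhS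
∂-coshS = mk≈ λ n → coeff (parity n)
  where
  coeff : ∀ {n} → Parity n → ∂ coshS n ≡ sinhS n
  coeff (even m) = trans (cong (ℕtoℚ (suc (m ℕ.* 2)) *_) (coshS-odd m))
    (trans (*-zeroʳ (ℕtoℚ (suc (m ℕ.* 2)))) (sym (sinhS-even m)))
  coeff (odd m)  = trans (cong (ℕtoℚ (suc (suc (m ℕ.* 2))) *_) (coshS-even (suc m)))
    (trans (invFact-suc (suc (m ℕ.* 2))) (sym (sinhS-odd m)))

∂-sinhS² : ∂ (sinhS ⊗ sinhS) ≈S coshS ⊗ sinhS ⊕ sinhS ⊗ coshS
∂-sinhS² = SR.trans (∂-leibniz sinhS sinhS) (SR.+-cong (SR.*-congʳ {sinhS} ∂-sinhS) (SR.*-congˡ {sinhS} ∂-sinhS))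

∂-coshS² : ∂ (coshS ⊗ coshS) ≈S sinhS ⊗ coshS ⊕ coshS ⊗ sinhS
∂-coshS² = SR.trans (∂-leibniz coshS coshS) (SR.+-cong (SR.*-congʳ {coshS} ∂-coshS) (SR.*-congˡ {coshS} ∂-coshS))

cosh²≈1+sinh² : coshS ⊗ coshS ≈S oneS ⊕ sinhS ⊗ sinhS
cosh²≈1+sinh² = x∙y⁻¹≈ε⇒x≈y (coshS ⊗ coshS) (oneS ⊕ sinhS ⊗ sinhS) (∂≈0⇒≈0 (coshS ⊗ coshS ⊖ (oneS ⊕ sinhS ⊗ sinhS)) ∂-difference refl)
  where
  open ≈S-Reasoning
  ∂-difference : ∂ (coshS ⊗ coshS ⊖ (oneS ⊕ sinhS ⊗ sinhS)) ≈S 0S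
  ∂-difference = begin
    ∂ (coshS ⊗ coshS ⊖ (oneS ⊕ sinhS ⊗ sinhS))
      ≈⟨ SR.trans (∂-homo-⊖ (coshS ⊗ coshS) (oneS ⊕ sinhS ⊗ sinhS))
                  (SR.+-congˡ {∂ (coshS ⊗ coshS)} (SR.-‿cong (∂-homo-+ oneS (sinhS ⊗ sinhS)))) ⟩
    ∂ (coshS ⊗ coshS) ⊖ (∂ oneS ⊕ ∂ (sinhS ⊗ sinhS))
      ≈⟨ SR.+-cong ∂-coshS² (SR.-‿cong (SR.+-cong (SR.trans ∂-oneS (SR.sym constS-0)) ∂-sinhS²)) ⟩
    (sinhS ⊗ coshS ⊕ coshS ⊗ sinhS) ⊖ (constS 0ℚ ⊕ (coshS ⊗ sinhS ⊕ sinhS ⊗ coshS))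
      ≈⟨ solve 2 (λ s c → (s :* c :+ c :* s) :- (con 0ℚ :+ (c :* s :+ s :* c)) := con 0ℚ) SR.refl sinhS coshS ⟩
    constS 0ℚ
      ≈⟨ constS-0 ⟩
    0S ∎

-- Y = sinh x cosh x = ½ sinh 2x and C₂ = cosh 2x.
Y C₂ : Series
Y = sinhS ⊗ coshS
C₂ = coshS ⊗ coshS ⊕ sinhS ⊗ sinhS

∂-Y : ∂ Y ≈S C₂
∂-Y = SR.trans (∂-leibniz sinhS coshS) (SR.+-cong (SR.*-congʳ {coshS} ∂-sinhS) (SR.*-congˡ {sinhS} ∂-coshS))

∂-C₂ : ∂ C₂ ≈S constS 4ℚ ⊗ Y
∂-C₂ = begin
  ∂ C₂                                               ≈⟨ ∂-homo-+ (coshS ⊗ coshS) (sinhS ⊗ sinhS) ⟩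
  ∂ (coshS ⊗ coshS) ⊕ ∂ (sinhS ⊗ sinhS)             ≈⟨ SR.+-cong ∂-coshS² ∂-sinhS² ⟩
  (sinhS ⊗ coshS ⊕ coshS ⊗ sinhS) ⊕ (coshS ⊗ sinhS ⊕ sinhS ⊗ coshS)
    ≈⟨ solve 2 (λ s c → (s :* c :+ c :* s) :+ (c :* s :+ s :* c) := con 4ℚ :* (s :* c)) SR.refl sinhS coshS ⟩
  constS 4ℚ ⊗ Y                                     ∎
  where open ≈S-Reasoning

C₂²≈1+4Y² : C₂ ⊗ C₂ ≈S oneS ⊕ constS 4ℚ ⊗ Y ⊗ Y
C₂²≈1+4Y² = begin
  C₂ ⊗ C₂
    ≈⟨ solve 2 (λ s c → (c :* c :+ s :* s) :* (c :* c :+ s :* s)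
                     := (c :* c :- s :* s) :* (c :* c :- s :* s) :+ con 4ℚ :* (s :* c) :* (s :* c)) SR.refl sinhS coshS ⟩
  (coshS ⊗ coshS ⊖ sinhS ⊗ sinhS) ⊗ (coshS ⊗ coshS ⊖ sinhS ⊗ sinhS) ⊕ constS 4ℚ ⊗ Y ⊗ Y
    ≈⟨ SR.+-congʳ {constS 4ℚ ⊗ Y ⊗ Y} (SR.trans (SR.*-cong cosh²-sinh² cosh²-sinh²) (SR.*-identityˡ oneS)) ⟩
  oneS ⊕ constS 4ℚ ⊗ Y ⊗ Y ∎
  where
  open ≈S-Reasoning
  cosh²-sinh² : coshS ⊗ coshS ⊖ sinhS ⊗ sinhS ≈S oneS
  cosh²-sinh² = SR.trans (SR.+-congʳ { -S (sinhS ⊗ sinhS)} cosh²≈1+sinh²)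
    (solve 2 (λ o h → (o :+ h) :- h := o) SR.refl oneS (sinhS ⊗ sinhS))

1+C₂≈2cosh² : oneS ⊕ C₂ ≈S constS 2ℚ ⊗ (coshS ⊗ coshS)
1+C₂≈2cosh² = begin
  oneS ⊕ C₂
    ≈⟨ solve 3 (λ o e h → o :+ (e :+ h) := e :+ (o :+ h)) SR.refl oneS (coshS ⊗ coshS) (sinhS ⊗ sinhS) ⟩
  coshS ⊗ coshS ⊕ (oneS ⊕ sinhS ⊗ sinhS)    ≈⟨ SR.+-congˡ {coshS ⊗ coshS} (SR.sym cosh²≈1+sinh²) ⟩
  coshS ⊗ coshS ⊕ coshS ⊗ coshS             ≈⟨ solve 1 (λ e → e :+ e := con 2ℚ :* e) SR.refl (coshS ⊗ coshS) ⟩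
  constS 2ℚ ⊗ (coshS ⊗ coshS)               ∎
  where open ≈S-Reasoning

-- sinh 2x − 2 sinh x cosh x and cosh 2x − C₂ solve f′ = 2g, g′ = 2f with f(0) = g(0) = 0.
dilate₂-sinhS : dilate₂ sinhS ≈S constS 2ℚ ⊗ Y
dilate₂-sinhS = x∙y⁻¹≈ε⇒x≈y (dilate₂ sinhS) (constS 2ℚ ⊗ Y) (mk≈ λ n → proj₁ (∂-system-uniqueness A B 2ℚ 2ℚ ∂A ∂B refl refl n))
  where
  open ≈S-Reasoning
  A B : Series
  A = dilate₂ sinhS ⊖ constS 2ℚ ⊗ Y
  B = dilate₂ coshS ⊖ C₂
  ∂A : ∂ A ≈S constS 2ℚ ⊗ B
  ∂A = begin
    ∂ A                                        ≈⟨ ∂-homo-⊖ (dilate₂ sinhS) (constS 2ℚ ⊗ Y) ⟩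
    ∂ (dilate₂ sinhS) ⊖ ∂ (constS 2ℚ ⊗ Y)      ≈⟨ SR.+-cong (SR.trans (∂-dilate₂ sinhS) (SR.*-congˡ {constS 2ℚ} (dilate₂-cong ∂-sinhS)))
                                                             (SR.-‿cong (SR.trans (∂-constS-⊗ 2ℚ Y) (SR.*-congˡ {constS 2ℚ} ∂-Y))) ⟩
    constS 2ℚ ⊗ dilate₂ coshS ⊖ constS 2ℚ ⊗ C₂
      ≈⟨ solve 2 (λ a b → con 2ℚ :* a :- con 2ℚ :* b := con 2ℚ :* (a :- b)) SR.refl (dilate₂ coshS) C₂ ⟩
    constS 2ℚ ⊗ B                              ∎
  ∂B : ∂ B ≈S constS 2ℚ ⊗ A
  ∂B = begin
    ∂ B                                        ≈⟨ ∂-homo-⊖ (dilate₂ coshS) C₂ ⟩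
    ∂ (dilate₂ coshS) ⊖ ∂ C₂
      ≈⟨ SR.+-cong (SR.trans (∂-dilate₂ coshS) (SR.*-congˡ {constS 2ℚ} (dilate₂-cong ∂-coshS))) (SR.-‿cong ∂-C₂) ⟩
    constS 2ℚ ⊗ dilate₂ sinhS ⊖ constS 4ℚ ⊗ Y
      ≈⟨ solve 2 (λ a b → con 2ℚ :* a :- con 4ℚ :* b := con 2ℚ :* (a :- con 2ℚ :* b)) SR.refl (dilate₂ sinhS) Y ⟩
    constS 2ℚ ⊗ A                              ∎

^S-2⊗ : ∀ f l → (constS 2ℚ ⊗ f) ^S l ≈S constS (ℕtoℚ (2 ^ l)) ⊗ f ^S l
^S-2⊗ f zero    = SR.sym (SR.trans (SR.*-congʳ {oneS} constS-1) (SR.*-identityˡ oneS))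
^S-2⊗ f (suc l) = begin
  (constS 2ℚ ⊗ f) ⊗ (constS 2ℚ ⊗ f) ^S l                 ≈⟨ SR.*-congˡ {constS 2ℚ ⊗ f} (^S-2⊗ f l) ⟩
  (constS 2ℚ ⊗ f) ⊗ (constS (ℕtoℚ (2 ^ l)) ⊗ f ^S l)     ≈⟨ solve 4 (λ a b c d → (a :* b) :* (c :* d) := (a :* c) :* (b :* d)) SR.refl
                                                               (constS 2ℚ) f (constS (ℕtoℚ (2 ^ l))) (f ^S l) ⟩
  (constS 2ℚ ⊗ constS (ℕtoℚ (2 ^ l))) ⊗ (f ⊗ f ^S l)     ≈⟨ SR.*-congʳ {f ⊗ f ^S l} (SR.trans (SR.sym (constS-homo-* 2ℚ (ℕtoℚ (2 ^ l))))
                                                                                            (constS-cong (sym (ℕtoℚ-homo-* 2 (2 ^ l))))) ⟩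
  constS (ℕtoℚ (2 ^ suc l)) ⊗ f ^S suc l                 ∎
  where open ≈S-Reasoning

2^[n∸l]*coeff-sinh^l : ∀ n l → l ≤ n → ℕtoℚ (2 ^ (n ∸ l)) * (sinhS ^S l) n ≡ (Y ^S l) n
2^[n∸l]*coeff-sinh^l n l l≤n = ℕtoℚ-cancelˡ (2 ^ l) {{ℕ.m^n≢0 2 l}} (begin
  ℕtoℚ (2 ^ l) * (ℕtoℚ (2 ^ (n ∸ l)) * (sinhS ^S l) n)  ≡⟨ *-assoc (ℕtoℚ (2 ^ l)) _ _ ⟨
  ℕtoℚ (2 ^ l) * ℕtoℚ (2 ^ (n ∸ l)) * (sinhS ^S l) n    ≡⟨ cong (_* (sinhS ^S l) n) (ℕtoℚ-homo-* (2 ^ l) (2 ^ (n ∸ l))) ⟨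
  ℕtoℚ (2 ^ l ℕ.* 2 ^ (n ∸ l)) * (sinhS ^S l) n         ≡⟨ cong (λ m → ℕtoℚ m * (sinhS ^S l) n) (ℕ.^-distribˡ-+-* 2 l (n ∸ l)) ⟨
  ℕtoℚ (2 ^ (l ℕ.+ (n ∸ l))) * (sinhS ^S l) n           ≡⟨ cong (λ m → ℕtoℚ (2 ^ m) * (sinhS ^S l) n) (ℕ.m+[n∸m]≡n l≤n) ⟩
  dilate₂ (sinhS ^S l) n                                ≡⟨ at (dilate₂-^S sinhS l) n ⟩
  (dilate₂ sinhS ^S l) n                                ≡⟨ at (^S-cong dilate₂-sinhS l) n ⟩
  ((constS 2ℚ ⊗ Y) ^S l) n                              ≡⟨ at (^S-2⊗ Y l) n ⟩
  (constS (ℕtoℚ (2 ^ l)) ⊗ Y ^S l) n                    ≡⟨ coeff-constS-*S (ℕtoℚ (2 ^ l)) (Y ^S l) n ⟩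
  ℕtoℚ (2 ^ l) * (Y ^S l) n                             ∎)
  where open ≡-Reasoning

-- Catalan numbers

[1+k]*[1+n]C[1+k]≡[1+n]*nCk : ∀ n k → suc k ℕ.* (suc n C suc k) ≡ suc n ℕ.* (n C k)
[1+k]*[1+n]C[1+k]≡[1+n]*nCk zero zero = refl
[1+k]*[1+n]C[1+k]≡[1+n]*nCk zero (suc k)
  rewrite k>n⇒nCk≡0 {1} {suc (suc k)} (s≤s (s≤s z≤n)) | k>n⇒nCk≡0 {0} {suc k} (s≤s z≤n) = ℕ.*-zeroʳ (suc (suc k))
[1+k]*[1+n]C[1+k]≡[1+n]*nCk (suc n) zero = begin
  1 ℕ.* (suc (suc n) C 1)              ≡⟨ cong (1 ℕ.*_) (nCk+nC[k+1]≡[n+1]C[k+1] (suc n) 0) ⟨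
  1 ℕ.* (suc n C 0 ℕ.+ suc n C 1)
    ≡⟨ cong (λ x → 1 ℕ.* (1 ℕ.+ x)) (trans (sym (ℕ.*-identityˡ (suc n C 1))) ([1+k]*[1+n]C[1+k]≡[1+n]*nCk n 0)) ⟩
  1 ℕ.* (1 ℕ.+ suc n ℕ.* (n C 0))      ≡⟨ lemma n ⟩
  suc (suc n) ℕ.* (suc n C 0)          ∎
  where
  open ≡-Reasoning
  lemma : ∀ n → 1 ℕ.* (1 ℕ.+ suc n ℕ.* 1) ≡ suc (suc n) ℕ.* 1
  lemma = ℕ-Solver.solve-∀
[1+k]*[1+n]C[1+k]≡[1+n]*nCk (suc n) (suc j) = begin
  suc (suc j) ℕ.* (suc (suc n) C suc (suc j))         ≡⟨ cong (suc (suc j) ℕ.*_) (nCk+nC[k+1]≡[n+1]C[k+1] (suc n) (suc j)) ⟨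
  suc (suc j) ℕ.* (X ℕ.+ X′)                          ≡⟨ split j X X′ ⟩
  (suc j ℕ.* X ℕ.+ X) ℕ.+ suc (suc j) ℕ.* X′
    ≡⟨ cong₂ (λ a b → (a ℕ.+ X) ℕ.+ b) ([1+k]*[1+n]C[1+k]≡[1+n]*nCk n j) ([1+k]*[1+n]C[1+k]≡[1+n]*nCk n (suc j)) ⟩
  (suc n ℕ.* (n C j) ℕ.+ X) ℕ.+ suc n ℕ.* (n C suc j) ≡⟨ regroup n (n C j) X (n C suc j) ⟩
  suc n ℕ.* (n C j ℕ.+ n C suc j) ℕ.+ X               ≡⟨ cong (λ x → suc n ℕ.* x ℕ.+ X) (nCk+nC[k+1]≡[n+1]C[k+1] n j) ⟩
  suc n ℕ.* X ℕ.+ X                                   ≡⟨ ℕ.+-comm (suc n ℕ.* X) X ⟩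
  suc (suc n) ℕ.* (suc n C suc j)                     ∎
  where
  open ≡-Reasoning
  X  = suc n C suc j
  X′ = suc n C suc (suc j)
  split : ∀ j x y → suc (suc j) ℕ.* (x ℕ.+ y) ≡ (suc j ℕ.* x ℕ.+ x) ℕ.+ suc (suc j) ℕ.* y
  split = ℕ-Solver.solve-∀
  regroup : ∀ n a x b → (suc n ℕ.* a ℕ.+ x) ℕ.+ suc n ℕ.* b ≡ suc n ℕ.* (a ℕ.+ b) ℕ.+ x
  regroup = ℕ-Solver.solve-∀

centralBinomial : ℕ → ℕ
centralBinomial m = (2 ℕ.* m) C m

[1+m]*centralBinomial[1+m] : ∀ m → suc m ℕ.* centralBinomial (suc m) ≡ 2 ℕ.* suc (2 ℕ.* m) ℕ.* centralBinomial m
[1+m]*centralBinomial[1+m] m = begin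
  suc m ℕ.* ((2 ℕ.* suc m) C suc m)                 ≡⟨ cong (λ x → suc m ℕ.* (x C suc m)) (ℕ.*-suc 2 m) ⟩
  suc m ℕ.* (suc (suc (2 ℕ.* m)) C suc m)           ≡⟨ [1+k]*[1+n]C[1+k]≡[1+n]*nCk (suc (2 ℕ.* m)) m ⟩
  suc (suc (2 ℕ.* m)) ℕ.* (suc (2 ℕ.* m) C m)       ≡⟨ cong (suc (suc (2 ℕ.* m)) ℕ.*_) symmetric ⟩
  suc (suc (2 ℕ.* m)) ℕ.* (suc (2 ℕ.* m) C suc m)   ≡⟨ factor-2 m (suc (2 ℕ.* m) C suc m) ⟩
  2 ℕ.* (suc m ℕ.* (suc (2 ℕ.* m) C suc m))         ≡⟨ cong (2 ℕ.*_) ([1+k]*[1+n]C[1+k]≡[1+n]*nCk (2 ℕ.* m) m) ⟩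
  2 ℕ.* (suc (2 ℕ.* m) ℕ.* ((2 ℕ.* m) C m))         ≡⟨ ℕ.*-assoc 2 (suc (2 ℕ.* m)) _ ⟨
  2 ℕ.* suc (2 ℕ.* m) ℕ.* ((2 ℕ.* m) C m)           ∎
  where
  open ≡-Reasoning
  factor-2 : ∀ m z → suc (suc (2 ℕ.* m)) ℕ.* z ≡ 2 ℕ.* (suc m ℕ.* z)
  factor-2 = ℕ-Solver.solve-∀
  [1+2m]∸m≡1+m : suc (2 ℕ.* m) ∸ m ≡ suc m
  [1+2m]∸m≡1+m = trans (ℕ.+-∸-assoc 1 (ℕ.m≤n*m m 2))
    (cong suc (trans (cong (_∸ m) (cong (m ℕ.+_) (ℕ.+-identityʳ m))) (ℕ.m+n∸n≡m m m)))
  symmetric : suc (2 ℕ.* m) C m ≡ suc (2 ℕ.* m) C suc m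
  symmetric = trans (nCk≡nC[n∸k] (ℕ.≤-trans (ℕ.m≤n*m m 2) (ℕ.n≤1+n _))) (cong (suc (2 ℕ.* m) C_) [1+2m]∸m≡1+m)

[1+m]*catalan : ∀ m → ℕtoℚ (suc m) * catalan m ≡ ℕtoℚ (centralBinomial m)
[1+m]*catalan m = begin
  ℕtoℚ (suc m) * (ℕtoℚ (centralBinomial m) * (ℤ.+ 1 ℚ./ suc m))  ≡⟨ x∙yz≈y∙xz (ℕtoℚ (suc m)) (ℕtoℚ (centralBinomial m)) (ℤ.+ 1 ℚ./ suc m) ⟩
  ℕtoℚ (centralBinomial m) * (ℕtoℚ (suc m) * (ℤ.+ 1 ℚ./ suc m))
    ≡⟨ cong (ℕtoℚ (centralBinomial m) *_) (trans (*-comm (ℕtoℚ (suc m)) (ℤ.+ 1 ℚ./ suc m)) (1/n*n≡1 (suc m))) ⟩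
  ℕtoℚ (centralBinomial m) * 1ℚ                                  ≡⟨ *-identityʳ _ ⟩
  ℕtoℚ (centralBinomial m)                                       ∎
  where open ≡-Reasoning

catalan-suc : ∀ m → ℕtoℚ (suc (suc m)) * catalan (suc m) ≡ ℕtoℚ (2 ℕ.* suc (2 ℕ.* m)) * catalan m
catalan-suc m = ℕtoℚ-cancelˡ (suc m) (begin
  ℕtoℚ (suc m) * (ℕtoℚ (suc (suc m)) * catalan (suc m))   ≡⟨ cong (ℕtoℚ (suc m) *_) ([1+m]*catalan (suc m)) ⟩
  ℕtoℚ (suc m) * ℕtoℚ (centralBinomial (suc m))           ≡⟨ ℕtoℚ-homo-* (suc m) (centralBinomial (suc m)) ⟨
  ℕtoℚ (suc m ℕ.* centralBinomial (suc m))                ≡⟨ cong ℕtoℚ ([1+m]*centralBinomial[1+m] m) ⟩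
  ℕtoℚ (2 ℕ.* suc (2 ℕ.* m) ℕ.* centralBinomial m)        ≡⟨ ℕtoℚ-homo-* (2 ℕ.* suc (2 ℕ.* m)) (centralBinomial m) ⟩
  ℕtoℚ (2 ℕ.* suc (2 ℕ.* m)) * ℕtoℚ (centralBinomial m)   ≡⟨ cong (ℕtoℚ (2 ℕ.* suc (2 ℕ.* m)) *_) ([1+m]*catalan m) ⟨
  ℕtoℚ (2 ℕ.* suc (2 ℕ.* m)) * (ℕtoℚ (suc m) * catalan m) ≡⟨ x∙yz≈y∙xz (ℕtoℚ (2 ℕ.* suc (2 ℕ.* m))) (ℕtoℚ (suc m)) (catalan m) ⟩
  ℕtoℚ (suc m) * (ℕtoℚ (2 ℕ.* suc (2 ℕ.* m)) * catalan m) ∎)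
  where open ≡-Reasoning

μ⁺ : ℕ → ℚ
μ⁺ l = μ (suc l)

μ⁺-even : ∀ m → μ⁺ (m ℕ.* 2) ≡ 0ℚ
μ⁺-even m = cong (λ r → if (r ℕ.≡ᵇ 0) ∧ ⌊ 1 ℕ.≤? suc (m ℕ.* 2) ⌋
                          then signℚ ((suc (m ℕ.* 2) / 2) ∸ 1) * catalan ((suc (m ℕ.* 2) / 2) ∸ 1) else 0ℚ)
                 ([m+kn]%n≡m%n 1 m 2)

μ⁺-odd : ∀ m → μ⁺ (suc (m ℕ.* 2)) ≡ signℚ m * catalan m
μ⁺-odd m = cong₂ (λ r h → if (r ℕ.≡ᵇ 0) ∧ ⌊ 1 ℕ.≤? suc m ℕ.* 2 ⌋ then signℚ (h ∸ 1) * catalan (h ∸ 1) else 0ℚ)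
                 (m*n%n≡0 (suc m) 2) (m*n/n≡m (suc m) 2)

[4+2m]*catalan[1+m] : ∀ m → ℕtoℚ (4 ℕ.+ m ℕ.* 2) * catalan (suc m) ≡ 4ℚ * ℕtoℚ (suc (m ℕ.* 2)) * catalan m
[4+2m]*catalan[1+m] m = begin
  ℕtoℚ (4 ℕ.+ m ℕ.* 2) * catalan (suc m)                  ≡⟨ cong (λ k → ℕtoℚ k * catalan (suc m)) (double-left m) ⟩
  ℕtoℚ (2 ℕ.* suc (suc m)) * catalan (suc m)              ≡⟨ cong (_* catalan (suc m)) (ℕtoℚ-homo-* 2 (suc (suc m))) ⟩
  2ℚ * ℕtoℚ (suc (suc m)) * catalan (suc m)               ≡⟨ *-assoc 2ℚ (ℕtoℚ (suc (suc m))) (catalan (suc m)) ⟩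
  2ℚ * (ℕtoℚ (suc (suc m)) * catalan (suc m))             ≡⟨ cong (2ℚ *_) (catalan-suc m) ⟩
  2ℚ * (ℕtoℚ (2 ℕ.* suc (2 ℕ.* m)) * catalan m)           ≡⟨ *-assoc 2ℚ (ℕtoℚ (2 ℕ.* suc (2 ℕ.* m))) (catalan m) ⟨
  2ℚ * ℕtoℚ (2 ℕ.* suc (2 ℕ.* m)) * catalan m             ≡⟨ cong (_* catalan m) (ℕtoℚ-homo-* 2 (2 ℕ.* suc (2 ℕ.* m))) ⟨
  ℕtoℚ (2 ℕ.* (2 ℕ.* suc (2 ℕ.* m))) * catalan m          ≡⟨ cong (λ k → ℕtoℚ k * catalan m) (double-right m) ⟩
  ℕtoℚ (4 ℕ.* suc (m ℕ.* 2)) * catalan m                  ≡⟨ cong (_* catalan m) (ℕtoℚ-homo-* 4 (suc (m ℕ.* 2))) ⟩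
  4ℚ * ℕtoℚ (suc (m ℕ.* 2)) * catalan m                   ∎
  where
  open ≡-Reasoning
  double-left : ∀ m → 4 ℕ.+ m ℕ.* 2 ≡ 2 ℕ.* suc (suc m)
  double-left = ℕ-Solver.solve-∀
  double-right : ∀ m → 2 ℕ.* (2 ℕ.* suc (2 ℕ.* m)) ≡ 4 ℕ.* suc (m ℕ.* 2)
  double-right = ℕ-Solver.solve-∀

μ⁺-recurrence : ∀ l → ℕtoℚ (3 ℕ.+ l) * μ⁺ (2 ℕ.+ l) + 4ℚ * ℕtoℚ l * μ⁺ l ≡ 0ℚ
μ⁺-recurrence l = go (parity l)
  where
  open ≡-Reasoning
  go : ∀ {l} → Parity l → ℕtoℚ (3 ℕ.+ l) * μ⁺ (2 ℕ.+ l) + 4ℚ * ℕtoℚ l * μ⁺ l ≡ 0ℚ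
  go (even m) = begin
    ℕtoℚ (3 ℕ.+ m ℕ.* 2) * μ⁺ (suc m ℕ.* 2) + 4ℚ * ℕtoℚ (m ℕ.* 2) * μ⁺ (m ℕ.* 2)
      ≡⟨ cong₂ (λ a b → ℕtoℚ (3 ℕ.+ m ℕ.* 2) * a + 4ℚ * ℕtoℚ (m ℕ.* 2) * b) (μ⁺-even (suc m)) (μ⁺-even m) ⟩
    ℕtoℚ (3 ℕ.+ m ℕ.* 2) * 0ℚ + 4ℚ * ℕtoℚ (m ℕ.* 2) * 0ℚ
      ≡⟨ cong₂ _+_ (*-zeroʳ (ℕtoℚ (3 ℕ.+ m ℕ.* 2))) (*-zeroʳ (4ℚ * ℕtoℚ (m ℕ.* 2))) ⟩
    0ℚ ∎
  go (odd m) = begin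
    a * μ⁺ (suc (suc m ℕ.* 2)) + b * μ⁺ (suc (m ℕ.* 2))
      ≡⟨ cong₂ (λ u v → a * u + b * v) (μ⁺-odd (suc m)) (μ⁺-odd m) ⟩
    a * (- signℚ m * catalan (suc m)) + b * (signℚ m * catalan m)
      ≡⟨ factor-sign a b (signℚ m) (catalan (suc m)) (catalan m) ⟩
    signℚ m * (b * catalan m - a * catalan (suc m))
      ≡⟨ cong (λ z → signℚ m * (b * catalan m - z)) ([4+2m]*catalan[1+m] m) ⟩
    signℚ m * (b * catalan m - b * catalan m)
      ≡⟨ cong (signℚ m *_) (+-inverseʳ (b * catalan m)) ⟩
    signℚ m * 0ℚ
      ≡⟨ *-zeroʳ (signℚ m) ⟩
    0ℚ ∎
    where
    a = ℕtoℚ (4 ℕ.+ m ℕ.* 2)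
    b = 4ℚ * ℕtoℚ (suc (m ℕ.* 2))
    factor-sign : ∀ x y s a b → x * (- s * a) + y * (s * b) ≡ s * (y * b - x * a)
    factor-sign = solve-∀ ℚ-ring

-- The Catalan series in Y

constS-suc : ∀ n → constS (ℕtoℚ (suc n)) ≈S oneS ⊕ constS (ℕtoℚ n)
constS-suc n = SR.trans (constS-cong (ℕtoℚ-suc n))
  (SR.trans (constS-homo-+ 1ℚ (ℕtoℚ n)) (SR.+-congʳ {constS (ℕtoℚ n)} constS-1))

∂-^S : ∀ f l → ∂ (f ^S suc l) ≈S constS (ℕtoℚ (suc l)) ⊗ f ^S l ⊗ ∂ f
∂-^S f zero = begin
  ∂ (f ⊗ oneS)                         ≈⟨ ∂-cong (SR.*-identityʳ f) ⟩
  ∂ f                                  ≈⟨ SR.*-identityˡ (∂ f) ⟨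
  oneS ⊗ ∂ f                           ≈⟨ SR.*-congʳ {∂ f} (SR.trans (SR.*-congʳ {oneS} constS-1) (SR.*-identityˡ oneS)) ⟨
  constS (ℕtoℚ 1) ⊗ oneS ⊗ ∂ f         ∎
  where open ≈S-Reasoning
∂-^S f (suc l) = begin
  ∂ (f ⊗ f ^S suc l)                                 ≈⟨ ∂-leibniz f (f ^S suc l) ⟩
  ∂ f ⊗ f ^S suc l ⊕ f ⊗ ∂ (f ^S suc l)              ≈⟨ SR.+-congˡ {∂ f ⊗ f ^S suc l} (SR.*-congˡ {f} (∂-^S f l)) ⟩
  ∂ f ⊗ (f ⊗ f ^S l) ⊕ f ⊗ (constS (ℕtoℚ (suc l)) ⊗ f ^S l ⊗ ∂ f)
    ≈⟨ solve 4 (λ d f p n → d :* (f :* p) :+ f :* (n :* p :* d) := (con 1ℚ :+ n) :* (f :* p) :* d) SR.refl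
         (∂ f) f (f ^S l) (constS (ℕtoℚ (suc l))) ⟩
  (constS 1ℚ ⊕ constS (ℕtoℚ (suc l))) ⊗ f ^S suc l ⊗ ∂ f
    ≈⟨ SR.*-congʳ {∂ f} (SR.*-congʳ {f ^S suc l} (SR.trans (SR.+-congʳ {constS (ℕtoℚ (suc l))} constS-1) (SR.sym (constS-suc (suc l))))) ⟩
  constS (ℕtoℚ (suc (suc l))) ⊗ f ^S suc l ⊗ ∂ f     ∎
  where open ≈S-Reasoning

q : Series
q = Y ⊗ C₂

q∂Y^l+Y^l : ∀ l → q ⊗ ∂ (Y ^S l) ⊕ Y ^S l ≈S constS (ℕtoℚ (suc l)) ⊗ Y ^S l ⊕ constS (4ℚ * ℕtoℚ l) ⊗ Y ^S (2 ℕ.+ l)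
q∂Y^l+Y^l zero = begin
  q ⊗ ∂ oneS ⊕ oneS                        ≈⟨ SR.+-congʳ {oneS} (SR.trans (SR.*-congˡ {q} ∂-oneS) (SR.zeroʳ q)) ⟩
  0S ⊕ oneS                                ≈⟨ SR.+-identityˡ oneS ⟩
  oneS                                     ≈⟨ solve 2 (λ o p → o := con 1ℚ :* o :+ con 0ℚ :* p) SR.refl oneS (Y ^S 2) ⟩
  constS 1ℚ ⊗ oneS ⊕ constS 0ℚ ⊗ Y ^S 2    ∎
  where open ≈S-Reasoning
q∂Y^l+Y^l (suc l) = begin
  q ⊗ ∂ (Y ^S suc l) ⊕ Y ^S suc l
    ≈⟨ SR.+-congʳ {Y ^S suc l} (SR.*-congˡ {q} (SR.trans (∂-^S Y l) (SR.*-congˡ {n ⊗ Y ^S l} ∂-Y))) ⟩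
  Y ⊗ C₂ ⊗ (n ⊗ Y ^S l ⊗ C₂) ⊕ Y ^S suc l
    ≈⟨ solve 4 (λ y c p n → y :* c :* (n :* p :* c) :+ y :* p := n :* (y :* p) :* (c :* c) :+ y :* p) SR.refl Y C₂ (Y ^S l) n ⟩
  n ⊗ Y ^S suc l ⊗ (C₂ ⊗ C₂) ⊕ Y ^S suc l
    ≈⟨ SR.+-congʳ {Y ^S suc l} (SR.*-congˡ {n ⊗ Y ^S suc l}
         (SR.trans C₂²≈1+4Y² (SR.+-congʳ {constS 4ℚ ⊗ Y ⊗ Y} (SR.sym constS-1)))) ⟩
  n ⊗ Y ^S suc l ⊗ (constS 1ℚ ⊕ constS 4ℚ ⊗ Y ⊗ Y) ⊕ Y ^S suc l
    ≈⟨ solve 3 (λ y p n → n :* (y :* p) :* (con 1ℚ :+ con 4ℚ :* y :* y) :+ y :* p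
                       := (con 1ℚ :+ n) :* (y :* p) :+ con 4ℚ :* n :* (y :* (y :* (y :* p)))) SR.refl Y (Y ^S l) n ⟩
  (constS 1ℚ ⊕ n) ⊗ Y ^S suc l ⊕ constS 4ℚ ⊗ n ⊗ Y ^S (3 ℕ.+ l)
    ≈⟨ SR.+-cong (SR.*-congʳ {Y ^S suc l} (SR.trans (SR.+-congʳ {n} constS-1) (SR.sym (constS-suc (suc l)))))
                 (SR.*-congʳ {Y ^S (3 ℕ.+ l)} (SR.sym (constS-homo-* 4ℚ (ℕtoℚ (suc l))))) ⟩
  constS (ℕtoℚ (2 ℕ.+ l)) ⊗ Y ^S suc l ⊕ constS (4ℚ * ℕtoℚ (suc l)) ⊗ Y ^S (3 ℕ.+ l) ∎
  where
  open ≈S-Reasoning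
  n = constS (ℕtoℚ (suc l))

catalanPartialSum : ℕ → Series
catalanPartialSum zero    = 0S
catalanPartialSum (suc N) = catalanPartialSum N ⊕ constS (μ⁺ N) ⊗ Y ^S N

coeff-catalanPartialSum : ∀ N n → catalanPartialSum N n ≡ Σ N (λ l → μ⁺ l * (Y ^S l) n)
coeff-catalanPartialSum zero    n = refl
coeff-catalanPartialSum (suc N) n =
  cong₂ _+_ (coeff-catalanPartialSum N n) (coeff-constS-*S (μ⁺ N) (Y ^S N) n)

residual : ℕ → Series
residual N = q ⊗ ∂ (catalanPartialSum N) ⊕ catalanPartialSum N ⊖ constS 2ℚ ⊗ Y

residual-suc : ∀ N → residual (suc N) ≈S residual N ⊕ constS (μ⁺ N) ⊗ (q ⊗ ∂ (Y ^S N) ⊕ Y ^S N)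
residual-suc N = begin
  q ⊗ ∂ (S ⊕ m ⊗ P) ⊕ (S ⊕ m ⊗ P) ⊖ constS 2ℚ ⊗ Y
    ≈⟨ SR.+-congʳ { -S (constS 2ℚ ⊗ Y)} (SR.+-congʳ {S ⊕ m ⊗ P} (SR.*-congˡ {q}
         (SR.trans (∂-homo-+ S (m ⊗ P)) (SR.+-congˡ {∂ S} (∂-constS-⊗ (μ⁺ N) P))))) ⟩
  q ⊗ (∂ S ⊕ m ⊗ ∂ P) ⊕ (S ⊕ m ⊗ P) ⊖ constS 2ℚ ⊗ Y
    ≈⟨ solve 7 (λ q a k b c d y → q :* (a :+ k :* b) :+ (c :+ k :* d) :- y := (q :* a :+ c :- y) :+ k :* (q :* b :+ d))
         SR.refl q (∂ S) m (∂ P) S P (constS 2ℚ ⊗ Y) ⟩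
  residual N ⊕ m ⊗ (q ⊗ ∂ P ⊕ P) ∎
  where
  open ≈S-Reasoning
  S = catalanPartialSum N
  m = constS (μ⁺ N)
  P = Y ^S N

residualTail : ℕ → Series
residualTail M =
  constS (4ℚ * ℕtoℚ M * μ⁺ M) ⊗ Y ^S (2 ℕ.+ M) ⊕ constS (4ℚ * ℕtoℚ (suc M) * μ⁺ (suc M)) ⊗ Y ^S (3 ℕ.+ M)

residual-2 : residual 2 ≈S residualTail 0
residual-2 = begin
  residual 2
    ≈⟨ SR.trans (residual-suc 1) (SR.+-congʳ {constS (μ⁺ 1) ⊗ (q ⊗ ∂ (Y ^S 1) ⊕ Y ^S 1)} (residual-suc 0)) ⟩
  (residual 0 ⊕ constS (μ⁺ 0) ⊗ (q ⊗ ∂ oneS ⊕ oneS)) ⊕ constS (μ⁺ 1) ⊗ (q ⊗ ∂ (Y ^S 1) ⊕ Y ^S 1)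
    ≈⟨ SR.+-cong (SR.+-cong residual-0 (SR.*-congˡ {constS (μ⁺ 0)} (q∂Y^l+Y^l 0)))
                 (SR.*-congˡ {constS (μ⁺ 1)} (SR.trans (q∂Y^l+Y^l 1) (SR.+-congʳ {constS (4ℚ * 1ℚ) ⊗ Y ^S 3} (SR.*-congˡ {constS 2ℚ} (SR.*-identityʳ Y))))) ⟩
  (q ⊗ constS 0ℚ ⊕ constS 0ℚ ⊖ constS 2ℚ ⊗ Y ⊕ constS (μ⁺ 0) ⊗ (constS 1ℚ ⊗ oneS ⊕ constS 0ℚ ⊗ Y ^S 2))
    ⊕ constS (μ⁺ 1) ⊗ (constS 2ℚ ⊗ Y ⊕ constS (4ℚ * 1ℚ) ⊗ Y ^S 3)
    ≈⟨ solve 5 (λ q y o P₂ P₃ → (q :* con 0ℚ :+ con 0ℚ :- con 2ℚ :* y :+ con (μ⁺ 0) :* (con 1ℚ :* o :+ con 0ℚ :* P₂))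
                                  :+ con (μ⁺ 1) :* (con 2ℚ :* y :+ con (4ℚ * 1ℚ) :* P₃)
                              := con (4ℚ * 0ℚ * μ⁺ 0) :* P₂ :+ con (4ℚ * 1ℚ * μ⁺ 1) :* P₃) SR.refl q Y oneS (Y ^S 2) (Y ^S 3) ⟩
  residualTail 0 ∎
  where
  open ≈S-Reasoning
  residual-0 : residual 0 ≈S q ⊗ constS 0ℚ ⊕ constS 0ℚ ⊖ constS 2ℚ ⊗ Y
  residual-0 = SR.+-congʳ { -S (constS 2ℚ ⊗ Y)} (SR.+-cong (SR.*-congˡ {q} (SR.trans (∂-constS 0ℚ) (SR.sym constS-0))) (SR.sym constS-0))
-- The recurrence for μ⁺ cancels the Y^(2+M) terms.
residualTail-suc : ∀ M →
  residualTail M ⊕ constS (μ⁺ (2 ℕ.+ M)) ⊗ (q ⊗ ∂ (Y ^S (2 ℕ.+ M)) ⊕ Y ^S (2 ℕ.+ M)) ≈S residualTail (suc M)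
residualTail-suc M = begin
  residualTail M ⊕ m ⊗ (q ⊗ ∂ P₂ ⊕ P₂)
    ≈⟨ SR.+-congˡ {residualTail M} (SR.*-congˡ {m} (q∂Y^l+Y^l (2 ℕ.+ M))) ⟩
  (a ⊗ P₂ ⊕ b ⊗ P₃) ⊕ m ⊗ (k ⊗ P₂ ⊕ e ⊗ P₄)
    ≈⟨ solve 8 (λ a b m k e P₂ P₃ P₄ → (a :* P₂ :+ b :* P₃) :+ m :* (k :* P₂ :+ e :* P₄)
                                     := b :* P₃ :+ m :* e :* P₄ :+ (m :* k :+ a) :* P₂) SR.refl a b m k e P₂ P₃ P₄ ⟩
  b ⊗ P₃ ⊕ m ⊗ e ⊗ P₄ ⊕ (m ⊗ k ⊕ a) ⊗ P₂
    ≈⟨ SR.+-cong (SR.+-congˡ {b ⊗ P₃} (SR.*-congʳ {P₄} top-coefficient)) (SR.trans (SR.*-congʳ {P₂} cancelled) (SR.zeroˡ P₂)) ⟩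
  b ⊗ P₃ ⊕ constS (4ℚ * ℕtoℚ (2 ℕ.+ M) * μ⁺ (2 ℕ.+ M)) ⊗ P₄ ⊕ 0S
    ≈⟨ SR.+-identityʳ _ ⟩
  b ⊗ P₃ ⊕ constS (4ℚ * ℕtoℚ (2 ℕ.+ M) * μ⁺ (2 ℕ.+ M)) ⊗ P₄ ∎
  where
  open ≈S-Reasoning
  a = constS (4ℚ * ℕtoℚ M * μ⁺ M)
  b = constS (4ℚ * ℕtoℚ (suc M) * μ⁺ (suc M))
  m = constS (μ⁺ (2 ℕ.+ M))
  k = constS (ℕtoℚ (3 ℕ.+ M))
  e = constS (4ℚ * ℕtoℚ (2 ℕ.+ M))
  P₂ = Y ^S (2 ℕ.+ M)
  P₃ = Y ^S (3 ℕ.+ M)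
  P₄ = Y ^S (4 ℕ.+ M)
  top-coefficient : m ⊗ e ≈S constS (4ℚ * ℕtoℚ (2 ℕ.+ M) * μ⁺ (2 ℕ.+ M))
  top-coefficient = SR.trans (SR.sym (constS-homo-* (μ⁺ (2 ℕ.+ M)) _)) (constS-cong (*-comm (μ⁺ (2 ℕ.+ M)) _))
  cancelled : m ⊗ k ⊕ a ≈S 0S
  cancelled = begin
    m ⊗ k ⊕ a                                                         ≈⟨ SR.+-congʳ {a} (SR.sym (constS-homo-* (μ⁺ (2 ℕ.+ M)) _)) ⟩
    constS (μ⁺ (2 ℕ.+ M) * ℕtoℚ (3 ℕ.+ M)) ⊕ a                        ≈⟨ SR.sym (constS-homo-+ _ _) ⟩
    constS (μ⁺ (2 ℕ.+ M) * ℕtoℚ (3 ℕ.+ M) + 4ℚ * ℕtoℚ M * μ⁺ M)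
      ≈⟨ constS-cong (trans (cong (_+ 4ℚ * ℕtoℚ M * μ⁺ M) (*-comm (μ⁺ (2 ℕ.+ M)) _)) (μ⁺-recurrence M)) ⟩
    constS 0ℚ                                                         ≈⟨ constS-0 ⟩
    0S                                                                ∎

residual≈residualTail : ∀ M → residual (2 ℕ.+ M) ≈S residualTail M
residual≈residualTail zero    = residual-2
residual≈residualTail (suc M) = SR.trans (residual-suc (2 ℕ.+ M))
  (SR.trans (SR.+-congʳ {constS (μ⁺ (2 ℕ.+ M)) ⊗ (q ⊗ ∂ (Y ^S (2 ℕ.+ M)) ⊕ Y ^S (2 ℕ.+ M))} (residual≈residualTail M))
            (residualTail-suc M))

residual-low : ∀ M n → n < 2 ℕ.+ M → residual (2 ℕ.+ M) n ≡ 0ℚ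
residual-low M n n<2+M = trans (at (residual≈residualTail M) n) (cong₂ _+_
  (coeff-*S-low (constS (4ℚ * ℕtoℚ M * μ⁺ M)) (Y ^S (2 ℕ.+ M)) n
     (λ k k≤n → ^S-low Y refl (2 ℕ.+ M) k (ℕ.≤-<-trans k≤n n<2+M)))
  (coeff-*S-low (constS (4ℚ * ℕtoℚ (suc M) * μ⁺ (suc M))) (Y ^S (3 ℕ.+ M)) n
     (λ k k≤n → ^S-low Y refl (3 ℕ.+ M) k (ℕ.m<n⇒m<1+n (ℕ.≤-<-trans k≤n n<2+M)))))

-- tanh

invS-inverse : ∀ g → g 0 ≡ 1ℚ → g ⊗ invS g ≈S oneS
invS-inverse g g₀≡1 = mk≈ coeff
  where
  open ≡-Reasoning
  h = invS g
  invPrefix-sum : ∀ k (f : ℕ → ℕ) → sumℚ (List.zipWith (λ i x → g i * x) (applyUpTo f (suc k)) (invPrefix g k))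
                                    ≡ Σ (suc k) (λ j → g (f j) * h (k ∸ j))
  invPrefix-sum zero    f = +-comm (g (f 0) * 1ℚ) 0ℚ
  invPrefix-sum (suc k) f = trans (cong (g (f 0) * h (suc k) +_) (invPrefix-sum k (f ∘ suc)))
                                  (sym (Σ-sucˡ (suc k) (λ j → g (f j) * h (suc k ∸ j))))
  coeff : ∀ k → (g ⊗ h) k ≡ oneS k
  coeff zero = cong (λ x → x * 1ℚ + 0ℚ) g₀≡1
  coeff (suc k) = begin
    (g ⊗ h) (suc k)                               ≡⟨ coeff-*S g h (suc k) ⟩
    Σ (suc (suc k)) (λ i → g i * h (suc k ∸ i))   ≡⟨ Σ-sucˡ (suc k) _ ⟩
    g 0 * h (suc k) + S                           ≡⟨ cong₂ (λ a b → a * b + S) g₀≡1 (cong -_ (invPrefix-sum k suc)) ⟩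
    1ℚ * (- S) + S                                ≡⟨ cong (_+ S) (*-identityˡ (- S)) ⟩
    - S + S                                       ≡⟨ +-inverseˡ S ⟩
    0ℚ                                            ∎
    where S = Σ (suc k) (λ j → g (suc j) * h (k ∸ j))

tan+sec*cos : tanPlusSec ⊗ cosS ≈S sinS ⊕ oneS
tan+sec*cos = begin
  (sinS ⊕ oneS) ⊗ invS cosS ⊗ cosS    ≈⟨ SR.*-assoc (sinS ⊕ oneS) (invS cosS) cosS ⟩
  (sinS ⊕ oneS) ⊗ (invS cosS ⊗ cosS)  ≈⟨ SR.*-congˡ {sinS ⊕ oneS} (SR.trans (SR.*-comm (invS cosS) cosS) (invS-inverse cosS refl)) ⟩
  (sinS ⊕ oneS) ⊗ oneS                ≈⟨ SR.*-identityʳ (sinS ⊕ oneS) ⟩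
  sinS ⊕ oneS                         ∎
  where open ≈S-Reasoning

-- tanh x = −i tan(ix), and tan is the odd part of tan + sec.
tanhS : Series
tanhS n = if isEven n then 0ℚ else signℚ ((n ∸ 1) / 2) * tanPlusSec n

tanhS-even : ∀ m → tanhS (m ℕ.* 2) ≡ 0ℚ
tanhS-even m = cong (if_then 0ℚ else signℚ ((m ℕ.* 2 ∸ 1) / 2) * tanPlusSec (m ℕ.* 2)) (isEven-even m)

tanhS-odd : ∀ m → tanhS (suc (m ℕ.* 2)) ≡ signℚ m * tanPlusSec (suc (m ℕ.* 2))
tanhS-odd m = cong₂ (λ b k → if b then 0ℚ else signℚ k * tanPlusSec (suc (m ℕ.* 2))) (isEven-odd m) (m*n/n≡m m 2)

cosS-even : ∀ m → cosS (m ℕ.* 2) ≡ signℚ m * invFact (m ℕ.* 2)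
cosS-even m = cong₂ (λ b k → if b then signℚ k * invFact (m ℕ.* 2) else 0ℚ) (isEven-even m) (m*n/n≡m m 2)

cosS-odd : ∀ m → cosS (suc (m ℕ.* 2)) ≡ 0ℚ
cosS-odd m = cong (if_then signℚ (suc (m ℕ.* 2) / 2) * invFact (suc (m ℕ.* 2)) else 0ℚ) (isEven-odd m)

sinS-odd : ∀ m → sinS (suc (m ℕ.* 2)) ≡ signℚ m * invFact (suc (m ℕ.* 2))
sinS-odd m = cong₂ (λ b k → if b then 0ℚ else signℚ k * invFact (suc (m ℕ.* 2))) (isEven-odd m) (m*n/n≡m m 2)

even≢odd : ∀ a b → a ℕ.* 2 ≢ suc (b ℕ.* 2)
even≢odd a b eq with trans (sym (isEven-even a)) (trans (cong isEven eq) (isEven-odd b))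
... | ()

tanhS*coshS-term-even : ∀ {i j} m → Parity i → Parity j → i ℕ.+ j ≡ m ℕ.* 2 → tanhS i * coshS j ≡ 0ℚ
tanhS*coshS-term-even {j = j} m (even a) _ _ = trans (cong (_* coshS j) (tanhS-even a)) (*-zeroˡ (coshS j))
tanhS*coshS-term-even m (odd a)  (odd b)  _  = trans (cong (tanhS (suc (a ℕ.* 2)) *_) (coshS-odd b)) (*-zeroʳ (tanhS (suc (a ℕ.* 2))))
tanhS*coshS-term-even m (odd a)  (even b) eq = ⊥-elim (even≢odd m (a ℕ.+ b) (trans (sym eq) (regroup a b)))
  where
  regroup : ∀ a b → suc (a ℕ.* 2) ℕ.+ b ℕ.* 2 ≡ suc ((a ℕ.+ b) ℕ.* 2)
  regroup = ℕ-Solver.solve-∀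

-- The sign of tanh i cosh j against tan i cos j is (-1)^((i-1)/2 + j/2) = (-1)^((i+j-1)/2) for i odd, j even.
tanhS*coshS-term-odd : ∀ {i j} m → Parity i → Parity j → i ℕ.+ j ≡ suc (m ℕ.* 2) →
  tanhS i * coshS j ≡ signℚ m * (tanPlusSec i * cosS j)
tanhS*coshS-term-odd m (even a) (even b) eq = ⊥-elim (even≢odd (a ℕ.+ b) m (trans (ℕ.*-distribʳ-+ 2 a b) eq))
tanhS*coshS-term-odd m (odd a)  (odd b)  eq = ⊥-elim (even≢odd (suc (a ℕ.+ b)) m (trans (regroup a b) eq))
  where
  regroup : ∀ a b → suc (a ℕ.+ b) ℕ.* 2 ≡ suc (a ℕ.* 2) ℕ.+ suc (b ℕ.* 2)
  regroup = ℕ-Solver.solve-∀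
tanhS*coshS-term-odd m (even a) (odd b)  _  = begin
  tanhS (a ℕ.* 2) * coshS (suc (b ℕ.* 2))               ≡⟨ cong (_* coshS (suc (b ℕ.* 2))) (tanhS-even a) ⟩
  0ℚ * coshS (suc (b ℕ.* 2))                            ≡⟨ *-zeroˡ (coshS (suc (b ℕ.* 2))) ⟩
  0ℚ                                                    ≡⟨ *-zeroʳ (signℚ m) ⟨
  signℚ m * 0ℚ                                          ≡⟨ cong (signℚ m *_) (*-zeroʳ (tanPlusSec (a ℕ.* 2))) ⟨
  signℚ m * (tanPlusSec (a ℕ.* 2) * 0ℚ)                 ≡⟨ cong (λ x → signℚ m * (tanPlusSec (a ℕ.* 2) * x)) (cosS-odd b) ⟨
  signℚ m * (tanPlusSec (a ℕ.* 2) * cosS (suc (b ℕ.* 2))) ∎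
  where open ≡-Reasoning
tanhS*coshS-term-odd m (odd a)  (even b) eq = begin
  tanhS i * coshS (b ℕ.* 2)                         ≡⟨ cong₂ _*_ (tanhS-odd a) (coshS-even b) ⟩
  signℚ a * t * invFact (b ℕ.* 2)                   ≡⟨ cong (λ x → x * t * invFact (b ℕ.* 2)) (*-identityʳ (signℚ a)) ⟨
  signℚ a * 1ℚ * t * invFact (b ℕ.* 2)              ≡⟨ cong (λ x → signℚ a * x * t * invFact (b ℕ.* 2)) (signℚ-square b) ⟨
  signℚ a * (signℚ b * signℚ b) * t * invFact (b ℕ.* 2)
                                                    ≡⟨ regroup (signℚ a) (signℚ b) t (invFact (b ℕ.* 2)) ⟩
  signℚ a * signℚ b * (t * (signℚ b * invFact (b ℕ.* 2)))
                                                    ≡⟨ cong₂ (λ s c → s * (t * c)) (trans (sym (signℚ-+ a b)) (cong signℚ a+b≡m)) (sym (cosS-even b)) ⟩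
  signℚ m * (t * cosS (b ℕ.* 2))                    ∎
  where
  open ≡-Reasoning
  i = suc (a ℕ.* 2)
  t = tanPlusSec i
  a+b≡m : a ℕ.+ b ≡ m
  a+b≡m = ℕ.*-cancelʳ-≡ (a ℕ.+ b) m 2 (trans (ℕ.*-distribʳ-+ 2 a b) (ℕ.suc-injective eq))
  regroup : ∀ sa sb x f → sa * (sb * sb) * x * f ≡ sa * sb * (x * (sb * f))
  regroup = solve-∀ ℚ-ring

tanhS*coshS : tanhS ⊗ coshS ≈S sinhS
tanhS*coshS = mk≈ λ n → coeff (parity n)
  where
  open ≡-Reasoning
  coeff : ∀ {n} → Parity n → (tanhS ⊗ coshS) n ≡ sinhS n
  coeff (even m) = begin
    (tanhS ⊗ coshS) (m ℕ.* 2)                          ≡⟨ coeff-*S tanhS coshS (m ℕ.* 2) ⟩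
    Σ (suc (m ℕ.* 2)) (λ i → tanhS i * coshS (m ℕ.* 2 ∸ i))
      ≡⟨ Σ-zero (suc (m ℕ.* 2)) (λ i i≤2m → tanhS*coshS-term-even m (parity i) (parity _) (ℕ.m+[n∸m]≡n (ℕ.≤-pred i≤2m))) ⟩
    0ℚ                                                 ≡⟨ sinhS-even m ⟨
    sinhS (m ℕ.* 2)                                    ∎
  coeff (odd m) = begin
    (tanhS ⊗ coshS) n                                  ≡⟨ coeff-*S tanhS coshS n ⟩
    Σ (suc n) (λ i → tanhS i * coshS (n ∸ i))
      ≡⟨ Σ-cong (suc n) (λ i i≤n → tanhS*coshS-term-odd m (parity i) (parity _) (ℕ.m+[n∸m]≡n (ℕ.≤-pred i≤n))) ⟩
    Σ (suc n) (λ i → signℚ m * (tanPlusSec i * cosS (n ∸ i)))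
                                                       ≡⟨ *-distribˡ-Σ (suc n) (signℚ m) _ ⟨
    signℚ m * Σ (suc n) (λ i → tanPlusSec i * cosS (n ∸ i))
                                                       ≡⟨ cong (signℚ m *_) (trans (sym (coeff-*S tanPlusSec cosS n)) (at tan+sec*cos n)) ⟩
    signℚ m * (sinS n + 0ℚ)                            ≡⟨ cong (signℚ m *_) (trans (+-identityʳ (sinS n)) (sinS-odd m)) ⟩
    signℚ m * (signℚ m * invFact n)                    ≡⟨ *-assoc (signℚ m) (signℚ m) (invFact n) ⟨
    signℚ m * signℚ m * invFact n                      ≡⟨ cong (_* invFact n) (signℚ-square m) ⟩
    1ℚ * invFact n                                     ≡⟨ *-identityˡ (invFact n) ⟩
    invFact n                                          ≡⟨ sinhS-odd m ⟨
    sinhS n                                            ∎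
    where n = suc (m ℕ.* 2)

tanhS*[1+C₂] : tanhS ⊗ (constS 1ℚ ⊕ C₂) ≈S constS 2ℚ ⊗ Y
tanhS*[1+C₂] = begin
  tanhS ⊗ (constS 1ℚ ⊕ C₂)                 ≈⟨ SR.*-congˡ {tanhS} (SR.trans (SR.+-congʳ {C₂} constS-1) 1+C₂≈2cosh²) ⟩
  tanhS ⊗ (constS 2ℚ ⊗ (coshS ⊗ coshS))
    ≈⟨ solve 3 (λ g k c → g :* (k :* (c :* c)) := k :* ((g :* c) :* c)) SR.refl tanhS (constS 2ℚ) coshS ⟩
  constS 2ℚ ⊗ (tanhS ⊗ coshS ⊗ coshS)      ≈⟨ SR.*-congˡ {constS 2ℚ} (SR.*-congʳ {coshS} tanhS*coshS) ⟩
  constS 2ℚ ⊗ Y                            ∎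
  where open ≈S-Reasoning

∂-[tanhS*[1+C₂]] : ∂ tanhS ⊗ (constS 1ℚ ⊕ C₂) ⊕ constS 4ℚ ⊗ tanhS ⊗ Y ≈S constS 2ℚ ⊗ C₂
∂-[tanhS*[1+C₂]] = begin
  ∂ tanhS ⊗ W ⊕ constS 4ℚ ⊗ tanhS ⊗ Y
    ≈⟨ solve 5 (λ dg w k g y → dg :* w :+ k :* g :* y := dg :* w :+ g :* (k :* y)) SR.refl (∂ tanhS) W (constS 4ℚ) tanhS Y ⟩
  ∂ tanhS ⊗ W ⊕ tanhS ⊗ (constS 4ℚ ⊗ Y)  ≈⟨ SR.+-congˡ {∂ tanhS ⊗ W} (SR.*-congˡ {tanhS} (SR.sym ∂W)) ⟩
  ∂ tanhS ⊗ W ⊕ tanhS ⊗ ∂ W              ≈⟨ ∂-leibniz tanhS W ⟨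
  ∂ (tanhS ⊗ W)                          ≈⟨ ∂-cong tanhS*[1+C₂] ⟩
  ∂ (constS 2ℚ ⊗ Y)                      ≈⟨ SR.trans (∂-constS-⊗ 2ℚ Y) (SR.*-congˡ {constS 2ℚ} ∂-Y) ⟩
  constS 2ℚ ⊗ C₂                         ∎
  where
  open ≈S-Reasoning
  W = constS 1ℚ ⊕ C₂
  ∂W : ∂ W ≈S constS 4ℚ ⊗ Y
  ∂W = SR.trans (∂-homo-+ (constS 1ℚ) C₂) (SR.trans (SR.+-cong (∂-constS 1ℚ) ∂-C₂) (SR.+-identityˡ _))

-- (1 + C₂)(q tanh′ + tanh − 2Y) is a combination of the three relations below,
-- and 1 + C₂ is invertible (constant term 2).
tanhS-ode : q ⊗ ∂ tanhS ⊕ tanhS ≈S constS 2ℚ ⊗ Y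
tanhS-ode = x∙y⁻¹≈ε⇒x≈y (q ⊗ ∂ tanhS ⊕ tanhS) (constS 2ℚ ⊗ Y) (*S≈0⇒≈0 (ℤ.+ 1 ℚ./ 2) W (q ⊗ ∂ tanhS ⊕ tanhS ⊖ constS 2ℚ ⊗ Y) refl (begin
  W ⊗ (Y ⊗ C₂ ⊗ ∂ tanhS ⊕ tanhS ⊖ constS 2ℚ ⊗ Y)
    ≈⟨ solve 4 (λ y c g dg → (con 1ℚ :+ c) :* (y :* c :* dg :+ g :- con 2ℚ :* y)
         := y :* c :* (dg :* (con 1ℚ :+ c) :+ con 4ℚ :* g :* y :- con 2ℚ :* c)
            :+ (con 1ℚ :+ c :- c :* c) :* (g :* (con 1ℚ :+ c) :- con 2ℚ :* y)
            :+ c :* g :* (c :* c :- con 4ℚ :* y :* y :- con 1ℚ)) SR.refl Y C₂ tanhS (∂ tanhS) ⟩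
  Y ⊗ C₂ ⊗ R₁ ⊕ (W ⊖ C₂ ⊗ C₂) ⊗ R₂ ⊕ C₂ ⊗ tanhS ⊗ R₃
    ≈⟨ SR.+-cong (SR.+-cong (SR.*-congˡ {Y ⊗ C₂} (x≈y⇒x∙y⁻¹≈ε ∂-[tanhS*[1+C₂]])) (SR.*-congˡ {W ⊖ C₂ ⊗ C₂} (x≈y⇒x∙y⁻¹≈ε tanhS*[1+C₂])))
                 (SR.*-congˡ {C₂ ⊗ tanhS} (x≈y⇒x∙y⁻¹≈ε (SR.trans C₂²≈1+4Y²′ (SR.sym constS-1)))) ⟩
  Y ⊗ C₂ ⊗ 0S ⊕ (W ⊖ C₂ ⊗ C₂) ⊗ 0S ⊕ C₂ ⊗ tanhS ⊗ 0S
    ≈⟨ SR.+-cong (SR.+-cong (SR.zeroʳ (Y ⊗ C₂)) (SR.zeroʳ (W ⊖ C₂ ⊗ C₂))) (SR.zeroʳ (C₂ ⊗ tanhS)) ⟩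
  0S ⊕ 0S ⊕ 0S
    ≈⟨ SR.trans (SR.+-identityʳ (0S ⊕ 0S)) (SR.+-identityʳ 0S) ⟩
  0S ∎))
  where
  open ≈S-Reasoning
  W = constS 1ℚ ⊕ C₂
  R₁ = ∂ tanhS ⊗ W ⊕ constS 4ℚ ⊗ tanhS ⊗ Y ⊖ constS 2ℚ ⊗ C₂
  R₂ = tanhS ⊗ W ⊖ constS 2ℚ ⊗ Y
  R₃ = C₂ ⊗ C₂ ⊖ constS 4ℚ ⊗ Y ⊗ Y ⊖ constS 1ℚ
  C₂²≈1+4Y²′ : C₂ ⊗ C₂ ⊖ constS 4ℚ ⊗ Y ⊗ Y ≈S oneS
  C₂²≈1+4Y²′ = SR.trans (SR.+-congʳ { -S (constS 4ℚ ⊗ Y ⊗ Y)} C₂²≈1+4Y²)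
    (solve 2 (λ o z → o :+ z :- z := o) SR.refl oneS (constS 4ℚ ⊗ Y ⊗ Y))

-- Weak set compositions and exponential generating functions

Σl : {A : Set} → (A → ℚ) → List A → ℚ
Σl f xs = sumℚ (map f xs)

Σl-++ : ∀ {A : Set} (f : A → ℚ) xs ys → Σl f (xs ++ ys) ≡ Σl f xs + Σl f ys
Σl-++ f []       ys = sym (+-identityˡ (Σl f ys))
Σl-++ f (x ∷ xs) ys = trans (cong (f x +_) (Σl-++ f xs ys)) (sym (+-assoc (f x) (Σl f xs) (Σl f ys)))

Σl-map : ∀ {A B : Set} (f : B → ℚ) (g : A → B) xs → Σl f (map g xs) ≡ Σl (f ∘ g) xs
Σl-map f g []       = refl
Σl-map f g (x ∷ xs) = cong (f (g x) +_) (Σl-map f g xs)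

Σl-concatMap : ∀ {A B : Set} (f : B → ℚ) (g : A → List B) xs → Σl f (concatMap g xs) ≡ Σl (λ x → Σl f (g x)) xs
Σl-concatMap f g []       = refl
Σl-concatMap f g (x ∷ xs) = trans (Σl-++ f (g x) (concatMap g xs)) (cong (Σl f (g x) +_) (Σl-concatMap f g xs))

Σl-filter : ∀ {A : Set} {P : A → Set} (P? : ∀ x → Dec (P x)) (f : A → ℚ) xs →
  Σl f (filter P? xs) ≡ Σl (λ x → if does (P? x) then f x else 0ℚ) xs
Σl-filter P? f [] = refl
Σl-filter P? f (x ∷ xs) with does (P? x)
... | true  = cong (f x +_) (Σl-filter P? f xs)
... | false = trans (Σl-filter P? f xs) (sym (+-identityˡ _))

Σl-cong : ∀ {A : Set} {f g : A → ℚ} xs → (∀ x → f x ≡ g x) → Σl f xs ≡ Σl g xs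
Σl-cong []       f≡g = refl
Σl-cong (x ∷ xs) f≡g = cong₂ _+_ (f≡g x) (Σl-cong xs f≡g)

*-distribˡ-Σl : ∀ {A : Set} a (f : A → ℚ) xs → a * Σl f xs ≡ Σl (λ x → a * f x) xs
*-distribˡ-Σl a f []       = *-zeroʳ a
*-distribˡ-Σl a f (x ∷ xs) = trans (*-distribˡ-+ a (f x) (Σl f xs)) (cong (a * f x +_) (*-distribˡ-Σl a f xs))

Σl-zero : ∀ {A : Set} {f : A → ℚ} xs → (∀ x → f x ≡ 0ℚ) → Σl f xs ≡ 0ℚ
Σl-zero []       f≡0 = refl
Σl-zero (x ∷ xs) f≡0 = trans (cong₂ _+_ (f≡0 x) (Σl-zero xs f≡0)) (+-identityˡ 0ℚ)

Σl-distrib-+ : ∀ {A : Set} (f g : A → ℚ) xs → Σl (λ x → f x + g x) xs ≡ Σl f xs + Σl g xs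
Σl-distrib-+ f g []       = refl
Σl-distrib-+ f g (x ∷ xs) = trans (cong (f x + g x +_) (Σl-distrib-+ f g xs)) (+-interchange (f x) (g x) _ _)
  where
  +-interchange : ∀ a b c d → (a + b) + (c + d) ≡ (a + c) + (b + d)
  +-interchange = solve-∀ ℚ-ring

Σl-swap : ∀ {A B : Set} (f : A → B → ℚ) xs ys → Σl (λ x → Σl (f x) ys) xs ≡ Σl (λ y → Σl (λ x → f x y) xs) ys
Σl-swap f []       ys = sym (Σl-zero ys (λ _ → refl))
Σl-swap f (x ∷ xs) ys = trans (cong (Σl (f x) ys +_) (Σl-swap f xs ys)) (sym (Σl-distrib-+ (f x) _ ys))

𝟙 : Bool → ℚ
𝟙 b = if b then 1ℚ else 0ℚ

𝟙-∧ : ∀ a b → 𝟙 (a ∧ b) ≡ 𝟙 a * 𝟙 b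
𝟙-∧ true  b = sym (*-identityˡ (𝟙 b))
𝟙-∧ false b = sym (*-zeroˡ (𝟙 b))

if-then-else-𝟙 : ∀ b x → (if does (b Bool.≟ true) then x else 0ℚ) ≡ 𝟙 b * x
if-then-else-𝟙 true  x = sym (*-identityˡ x)
if-then-else-𝟙 false x = sym (*-zeroˡ x)

boolLists : ℕ → List (List Bool)
boolLists zero    = [] ∷ []
boolLists (suc l) = map (true ∷_) (boolLists l) ++ map (false ∷_) (boolLists l)

Σl-boolLists-suc : ∀ l (F : List Bool → ℚ) →
  Σl F (boolLists (suc l)) ≡ Σl (F ∘ (true ∷_)) (boolLists l) + Σl (F ∘ (false ∷_)) (boolLists l)
Σl-boolLists-suc l F = trans (Σl-++ F (map (true ∷_) (boolLists l)) _)
  (cong₂ _+_ (Σl-map F (true ∷_) (boolLists l)) (Σl-map F (false ∷_) (boolLists l)))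

countTrue : List Bool → ℕ
countTrue []           = 0
countTrue (true ∷ bs)  = suc (countTrue bs)
countTrue (false ∷ bs) = countTrue bs

heads : ∀ {n} → List (Subset (suc n)) → List Bool
heads = map Vec.head

tails : ∀ {n} → List (Subset (suc n)) → List (Subset n)
tails = map Vec.tail

-- A list of l subsets of [n+1] is a list of l bits (membership of the first element) and l subsets of [n].
Σl-subsetLists-suc : ∀ {n} l (G : List Bool → List (Subset n) → ℚ) →
  Σl (λ φ → G (heads φ) (tails φ)) (subsetLists (suc n) l) ≡ Σl (λ bs → Σl (G bs) (subsetLists n l)) (boolLists l)
Σl-subsetLists-suc zero    G = sym (+-identityʳ _)
Σl-subsetLists-suc {n} (suc l) G = begin
  Σl (λ φ → G (heads φ) (tails φ)) (concatMap (λ s → map (s ∷_) (subsetLists (suc n) l)) (allSubsets (suc n)))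
    ≡⟨ Σl-concatMap _ _ (allSubsets (suc n)) ⟩
  Σl (λ s → Σl (λ φ → G (heads φ) (tails φ)) (map (s ∷_) (subsetLists (suc n) l))) (allSubsets (suc n))
    ≡⟨ Σl-cong (allSubsets (suc n)) (λ s → trans (Σl-map _ (s ∷_) (subsetLists (suc n) l))
                                                  (Σl-subsetLists-suc l (λ bs φ → G (Vec.head s ∷ bs) (Vec.tail s ∷ φ)))) ⟩
  Σl X (map (inside ∷_) (allSubsets n) ++ map (outside ∷_) (allSubsets n))
    ≡⟨ Σl-++ X (map (inside ∷_) (allSubsets n)) (map (outside ∷_) (allSubsets n)) ⟩
  Σl X (map (inside ∷_) (allSubsets n)) + Σl X (map (outside ∷_) (allSubsets n))
    ≡⟨ cong₂ _+_ (trans (Σl-map X (inside ∷_) (allSubsets n)) (first-bit true))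
                 (trans (Σl-map X (outside ∷_) (allSubsets n)) (first-bit false)) ⟩
  Σl (λ bs → Σl (G (true ∷ bs)) (subsetLists n (suc l))) (boolLists l)
    + Σl (λ bs → Σl (G (false ∷ bs)) (subsetLists n (suc l))) (boolLists l)
    ≡⟨ Σl-boolLists-suc l (λ bs → Σl (G bs) (subsetLists n (suc l))) ⟨
  Σl (λ bs → Σl (G bs) (subsetLists n (suc l))) (boolLists (suc l)) ∎
  where
  open ≡-Reasoning
  X : Subset (suc n) → ℚ
  X s = Σl (λ bs → Σl (λ φ → G (Vec.head s ∷ bs) (Vec.tail s ∷ φ)) (subsetLists n l)) (boolLists l)
  first-bit : ∀ b → Σl (X ∘ (b ∷_)) (allSubsets n) ≡ Σl (λ bs → Σl (G (b ∷ bs)) (subsetLists n (suc l))) (boolLists l)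
  first-bit b = begin
    Σl (λ s → Σl (λ bs → Σl (λ φ → G (b ∷ bs) (s ∷ φ)) (subsetLists n l)) (boolLists l)) (allSubsets n)
      ≡⟨ Σl-swap (λ s bs → Σl (λ φ → G (b ∷ bs) (s ∷ φ)) (subsetLists n l)) (allSubsets n) (boolLists l) ⟩
    Σl (λ bs → Σl (λ s → Σl (λ φ → G (b ∷ bs) (s ∷ φ)) (subsetLists n l)) (allSubsets n)) (boolLists l)
      ≡⟨ Σl-cong (boolLists l) (λ bs → sym (trans (Σl-concatMap (G (b ∷ bs)) (λ s → map (s ∷_) (subsetLists n l)) (allSubsets n))
            (Σl-cong (allSubsets n) (λ s → Σl-map (G (b ∷ bs)) (s ∷_) (subsetLists n l))))) ⟩
    Σl (λ bs → Σl (G (b ∷ bs)) (subsetLists n (suc l))) (boolLists l) ∎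

Σl-subsetLists-zero : ∀ l (F : List (Subset 0) → ℚ) → Σl F (subsetLists 0 l) ≡ F (List.replicate l [])
Σl-subsetLists-zero zero    F = +-identityʳ (F [])
Σl-subsetLists-zero (suc l) F = trans (Σl-++ F (map ([] ∷_) (subsetLists 0 l)) [])
  (trans (+-identityʳ _) (trans (Σl-map F ([] ∷_) (subsetLists 0 l)) (Σl-subsetLists-zero l (F ∘ ([] ∷_)))))

Σl-subsetLists-length : ∀ {n} l (H : ℕ → List (Subset n) → ℚ) →
  Σl (λ φ → H (length φ) φ) (subsetLists n l) ≡ Σl (H l) (subsetLists n l)
Σl-subsetLists-length zero    H = refl
Σl-subsetLists-length {n} (suc l) H = begin
  Σl (λ φ → H (length φ) φ) (concatMap (λ s → map (s ∷_) (subsetLists n l)) (allSubsets n))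
    ≡⟨ Σl-concatMap _ _ (allSubsets n) ⟩
  Σl (λ s → Σl (λ φ → H (length φ) φ) (map (s ∷_) (subsetLists n l))) (allSubsets n)
    ≡⟨ Σl-cong (allSubsets n) (λ s → trans (Σl-map _ (s ∷_) (subsetLists n l))
         (trans (Σl-subsetLists-length l (λ k φ → H (suc k) (s ∷ φ))) (sym (Σl-map (H (suc l)) (s ∷_) (subsetLists n l))))) ⟩
  Σl (λ s → Σl (H (suc l)) (map (s ∷_) (subsetLists n l))) (allSubsets n)
    ≡⟨ Σl-concatMap _ _ (allSubsets n) ⟨
  Σl (H (suc l)) (concatMap (λ s → map (s ∷_) (subsetLists n l)) (allSubsets n)) ∎
  where open ≡-Reasoning

count-zero∈ : ∀ {n} (φ : List (Subset (suc n))) → length (filter (Fin.zero ∈?_) φ) ≡ countTrue (heads φ)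
count-zero∈ [] = refl
count-zero∈ ((true ∷ s) ∷ φ)  = cong suc (count-zero∈ φ)
count-zero∈ ((false ∷ s) ∷ φ) = count-zero∈ φ

count-suc∈ : ∀ {n} (x : Fin n) (φ : List (Subset (suc n))) →
  length (filter (Fin.suc x ∈?_) φ) ≡ length (filter (x ∈?_) (tails φ))
count-suc∈ x [] = refl
count-suc∈ x ((b ∷ s) ∷ φ) with does (x ∈? s)
... | true  = cong suc (count-suc∈ x φ)
... | false = count-suc∈ x φ

allB-tabulate-suc : ∀ {m n} (f : Fin m → Fin n) (P : Fin (suc n) → Bool) (Q : Fin n → Bool) → (∀ x → P (Fin.suc x) ≡ Q x) →
  allB P (Vec.toList (Vec.tabulate (Fin.suc ∘ f))) ≡ allB Q (Vec.toList (Vec.tabulate f))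
allB-tabulate-suc {zero}  f P Q P≡Q = refl
allB-tabulate-suc {suc m} f P Q P≡Q = cong₂ _∧_ (P≡Q (f Fin.zero)) (allB-tabulate-suc (f ∘ Fin.suc) P Q P≡Q)

exactlyOneBlock-split : ∀ {n} (φ : List (Subset (suc n))) →
  exactlyOneBlock φ ≡ (countTrue (heads φ) ℕ.≡ᵇ 1) ∧ exactlyOneBlock (tails φ)
exactlyOneBlock-split φ = cong₂ _∧_ (cong (ℕ._≡ᵇ 1) (count-zero∈ φ))
  (allB-tabulate-suc id (λ x → length (filter (x ∈?_) φ) ℕ.≡ᵇ 1) (λ x → length (filter (x ∈?_) (tails φ)) ℕ.≡ᵇ 1)
     (λ x → cong (ℕ._≡ᵇ 1) (count-suc∈ x φ)))

Weight : Set
Weight = ℕ → ℚ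

-- Missing weights or blocks contribute the factor 1.
blockWeight : ∀ {n} → List Weight → List (Subset n) → ℚ
blockWeight (w ∷ ws) (s ∷ φ) = w ∣ s ∣ * blockWeight ws φ
blockWeight []       _       = 1ℚ
blockWeight (_ ∷ _)  []      = 1ℚ

shiftAt : List Bool → List Weight → List Weight
shiftAt (true ∷ bs)  (w ∷ ws) = (w ∘ suc) ∷ shiftAt bs ws
shiftAt (false ∷ bs) (w ∷ ws) = w ∷ shiftAt bs ws
shiftAt []           ws       = ws
shiftAt (_ ∷ _)      []       = []

length-shiftAt : ∀ bs ws → length (shiftAt bs ws) ≡ length ws
length-shiftAt (true ∷ bs)  (w ∷ ws) = cong suc (length-shiftAt bs ws)
length-shiftAt (false ∷ bs) (w ∷ ws) = cong suc (length-shiftAt bs ws)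
length-shiftAt []           ws       = refl
length-shiftAt (true ∷ _)   []       = refl
length-shiftAt (false ∷ _)  []       = refl

blockWeight-split : ∀ {n} ws (φ : List (Subset (suc n))) → blockWeight ws φ ≡ blockWeight (shiftAt (heads φ) ws) (tails φ)
blockWeight-split []       []                = refl
blockWeight-split []       ((true ∷ _) ∷ _)  = refl
blockWeight-split []       ((false ∷ _) ∷ _) = refl
blockWeight-split (w ∷ ws) []                = refl
blockWeight-split (w ∷ ws) ((true ∷ s) ∷ φ)  = cong (w (suc ∣ s ∣) *_) (blockWeight-split ws φ)
blockWeight-split (w ∷ ws) ((false ∷ s) ∷ φ) = cong (w ∣ s ∣ *_) (blockWeight-split ws φ)

-- Blocks may be empty: exactlyOneBlock does not exclude them.
weakCompositionSum : ℕ → ℕ → List Weight → ℚ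
weakCompositionSum n l ws = Σl (λ φ → 𝟙 (exactlyOneBlock φ) * blockWeight ws φ) (subsetLists n l)

weakCompositionSum-suc : ∀ n l ws →
  weakCompositionSum (suc n) l ws ≡ Σl (λ bs → 𝟙 (countTrue bs ℕ.≡ᵇ 1) * weakCompositionSum n l (shiftAt bs ws)) (boolLists l)
weakCompositionSum-suc n l ws = begin
  weakCompositionSum (suc n) l ws
    ≡⟨ Σl-cong (subsetLists (suc n) l) split ⟩
  Σl (λ φ → G (heads φ) (tails φ)) (subsetLists (suc n) l)
    ≡⟨ Σl-subsetLists-suc l G ⟩
  Σl (λ bs → Σl (G bs) (subsetLists n l)) (boolLists l)
    ≡⟨ Σl-cong (boolLists l) (λ bs → sym (*-distribˡ-Σl (𝟙 (countTrue bs ℕ.≡ᵇ 1)) _ (subsetLists n l))) ⟩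
  Σl (λ bs → 𝟙 (countTrue bs ℕ.≡ᵇ 1) * weakCompositionSum n l (shiftAt bs ws)) (boolLists l) ∎
  where
  open ≡-Reasoning
  G : List Bool → List (Subset n) → ℚ
  G bs φ = 𝟙 (countTrue bs ℕ.≡ᵇ 1) * (𝟙 (exactlyOneBlock φ) * blockWeight (shiftAt bs ws) φ)
  split : ∀ φ → 𝟙 (exactlyOneBlock φ) * blockWeight ws φ ≡ G (heads φ) (tails φ)
  split φ = trans (cong₂ _*_ (trans (cong 𝟙 (exactlyOneBlock-split φ)) (𝟙-∧ _ (exactlyOneBlock (tails φ))))
                             (blockWeight-split ws φ))
                  (*-assoc (𝟙 (countTrue (heads φ) ℕ.≡ᵇ 1)) _ _)

shifts : List Weight → List (List Weight)
shifts []       = []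
shifts (w ∷ ws) = ((w ∘ suc) ∷ ws) ∷ map (w ∷_) (shifts ws)

Σl-no-shift : ∀ ws (Z : List Weight → ℚ) → Σl (λ bs → 𝟙 (countTrue bs ℕ.≡ᵇ 0) * Z (shiftAt bs ws)) (boolLists (length ws)) ≡ Z ws
Σl-no-shift []       Z = trans (+-identityʳ _) (*-identityˡ (Z []))
Σl-no-shift (w ∷ ws) Z = begin
  Σl F (boolLists (suc (length ws)))
    ≡⟨ Σl-boolLists-suc (length ws) F ⟩
  Σl (λ bs → 0ℚ * Z ((w ∘ suc) ∷ shiftAt bs ws)) (boolLists (length ws))
    + Σl (λ bs → 𝟙 (countTrue bs ℕ.≡ᵇ 0) * Z (w ∷ shiftAt bs ws)) (boolLists (length ws))
    ≡⟨ cong₂ _+_ (Σl-zero (boolLists (length ws)) (λ bs → *-zeroˡ (Z ((w ∘ suc) ∷ shiftAt bs ws)))) (Σl-no-shift ws (Z ∘ (w ∷_))) ⟩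
  0ℚ + Z (w ∷ ws)
    ≡⟨ +-identityˡ (Z (w ∷ ws)) ⟩
  Z (w ∷ ws) ∎
  where
  open ≡-Reasoning
  F : List Bool → ℚ
  F bs = 𝟙 (countTrue bs ℕ.≡ᵇ 0) * Z (shiftAt bs (w ∷ ws))

Σl-one-shift : ∀ ws (Z : List Weight → ℚ) → Σl (λ bs → 𝟙 (countTrue bs ℕ.≡ᵇ 1) * Z (shiftAt bs ws)) (boolLists (length ws)) ≡ Σl Z (shifts ws)
Σl-one-shift []       Z = trans (+-identityʳ _) (*-zeroˡ (Z []))
Σl-one-shift (w ∷ ws) Z = begin
  Σl F (boolLists (suc (length ws)))
    ≡⟨ Σl-boolLists-suc (length ws) F ⟩
  Σl (λ bs → 𝟙 (countTrue bs ℕ.≡ᵇ 0) * Z ((w ∘ suc) ∷ shiftAt bs ws)) (boolLists (length ws))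
    + Σl (λ bs → 𝟙 (countTrue bs ℕ.≡ᵇ 1) * Z (w ∷ shiftAt bs ws)) (boolLists (length ws))
    ≡⟨ cong₂ _+_ (Σl-no-shift ws (Z ∘ ((w ∘ suc) ∷_))) (Σl-one-shift ws (Z ∘ (w ∷_))) ⟩
  Z ((w ∘ suc) ∷ ws) + Σl (Z ∘ (w ∷_)) (shifts ws)
    ≡⟨ cong (Z ((w ∘ suc) ∷ ws) +_) (Σl-map Z (w ∷_) (shifts ws)) ⟨
  Σl Z (shifts (w ∷ ws)) ∎
  where
  open ≡-Reasoning
  F : List Bool → ℚ
  F bs = 𝟙 (countTrue bs ℕ.≡ᵇ 1) * Z (shiftAt bs (w ∷ ws))

egf : Weight → Series
egf w k = w k * invFact k

egfProduct : List Weight → Series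
egfProduct []       = oneS
egfProduct (w ∷ ws) = egf w ⊗ egfProduct ws

seriesSum : List Series → Series
seriesSum []       = 0S
seriesSum (f ∷ fs) = f ⊕ seriesSum fs

coeff-seriesSum : ∀ fs n → seriesSum fs n ≡ Σl (λ f → f n) fs
coeff-seriesSum []       n = refl
coeff-seriesSum (f ∷ fs) n = cong (f n +_) (coeff-seriesSum fs n)

∂-egf : ∀ w → ∂ (egf w) ≈S egf (w ∘ suc)
∂-egf w = mk≈ λ k → trans (x∙yz≈y∙xz (ℕtoℚ (suc k)) (w (suc k)) (invFact (suc k))) (cong (w (suc k) *_) (invFact-suc k))

seriesSum-map-∷ : ∀ w vs → seriesSum (map egfProduct (map (w ∷_) vs)) ≈S egf w ⊗ seriesSum (map egfProduct vs)
seriesSum-map-∷ w []       = SR.sym (SR.zeroʳ (egf w))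
seriesSum-map-∷ w (v ∷ vs) = SR.trans (SR.+-congˡ {egf w ⊗ egfProduct v} (seriesSum-map-∷ w vs))
  (SR.sym (SR.distribˡ (egf w) (egfProduct v) (seriesSum (map egfProduct vs))))

∂-egfProduct : ∀ ws → ∂ (egfProduct ws) ≈S seriesSum (map egfProduct (shifts ws))
∂-egfProduct []       = ∂-oneS
∂-egfProduct (w ∷ ws) = begin
  ∂ (egf w ⊗ egfProduct ws)                                    ≈⟨ ∂-leibniz (egf w) (egfProduct ws) ⟩
  ∂ (egf w) ⊗ egfProduct ws ⊕ egf w ⊗ ∂ (egfProduct ws)
    ≈⟨ SR.+-cong (SR.*-congʳ {egfProduct ws} (∂-egf w)) (SR.*-congˡ {egf w} (∂-egfProduct ws)) ⟩
  egf (w ∘ suc) ⊗ egfProduct ws ⊕ egf w ⊗ seriesSum (map egfProduct (shifts ws))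
                                                               ≈⟨ SR.+-congˡ {egf (w ∘ suc) ⊗ egfProduct ws} (seriesSum-map-∷ w (shifts ws)) ⟨
  seriesSum (map egfProduct (shifts (w ∷ ws)))                 ∎
  where open ≈S-Reasoning

egfProduct-0 : ∀ ws → egfProduct ws 0 ≡ blockWeight ws (List.replicate (length ws) ([] {A = Bool}))
egfProduct-0 []       = refl
egfProduct-0 (w ∷ ws) = trans (+-identityʳ _) (cong₂ _*_ (*-identityʳ (w 0)) (egfProduct-0 ws))

-- Placing the first element in one of the blocks shifts that block's weight, which is exactly the Leibniz rule for ∂.
weakCompositionSum-egf : ∀ n ws → weakCompositionSum n (length ws) ws ≡ ℕtoℚ (n !) * egfProduct ws n
weakCompositionSum-egf zero ws = begin
  weakCompositionSum 0 (length ws) ws                       ≡⟨ Σl-subsetLists-zero (length ws) _ ⟩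
  1ℚ * blockWeight ws (List.replicate (length ws) [])       ≡⟨ cong (1ℚ *_) (egfProduct-0 ws) ⟨
  1ℚ * egfProduct ws 0                                      ∎
  where open ≡-Reasoning
weakCompositionSum-egf (suc n) ws = begin
  weakCompositionSum (suc n) (length ws) ws
    ≡⟨ weakCompositionSum-suc n (length ws) ws ⟩
  Σl (λ bs → 𝟙 (countTrue bs ℕ.≡ᵇ 1) * weakCompositionSum n (length ws) (shiftAt bs ws)) (boolLists (length ws))
    ≡⟨ Σl-cong (boolLists (length ws)) (λ bs → cong (𝟙 (countTrue bs ℕ.≡ᵇ 1) *_) (induction-step bs)) ⟩
  Σl (λ bs → 𝟙 (countTrue bs ℕ.≡ᵇ 1) * (ℕtoℚ (n !) * egfProduct (shiftAt bs ws) n)) (boolLists (length ws))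
    ≡⟨ Σl-one-shift ws (λ v → ℕtoℚ (n !) * egfProduct v n) ⟩
  Σl (λ v → ℕtoℚ (n !) * egfProduct v n) (shifts ws)
    ≡⟨ *-distribˡ-Σl (ℕtoℚ (n !)) (λ v → egfProduct v n) (shifts ws) ⟨
  ℕtoℚ (n !) * Σl (λ v → egfProduct v n) (shifts ws)
    ≡⟨ cong (ℕtoℚ (n !) *_) (trans (coeff-seriesSum (map egfProduct (shifts ws)) n) (Σl-map (λ f → f n) egfProduct (shifts ws))) ⟨
  ℕtoℚ (n !) * seriesSum (map egfProduct (shifts ws)) n
    ≡⟨ cong (ℕtoℚ (n !) *_) (at (∂-egfProduct ws) n) ⟨
  ℕtoℚ (n !) * (ℕtoℚ (suc n) * egfProduct ws (suc n))
    ≡⟨ *-assoc (ℕtoℚ (n !)) (ℕtoℚ (suc n)) _ ⟨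
  ℕtoℚ (n !) * ℕtoℚ (suc n) * egfProduct ws (suc n)
    ≡⟨ cong (_* egfProduct ws (suc n)) (trans (*-comm (ℕtoℚ (n !)) (ℕtoℚ (suc n))) (sym (ℕtoℚ-homo-* (suc n) (n !)))) ⟩
  ℕtoℚ (suc n !) * egfProduct ws (suc n) ∎
  where
  open ≡-Reasoning
  induction-step : ∀ bs → weakCompositionSum n (length ws) (shiftAt bs ws) ≡ ℕtoℚ (n !) * egfProduct (shiftAt bs ws) n
  induction-step bs = trans (cong (λ l → weakCompositionSum n l (shiftAt bs ws)) (sym (length-shiftAt bs ws)))
                            (weakCompositionSum-egf n (shiftAt bs ws))

oddIndicator : Weight
oddIndicator k = 𝟙 (k % 2 ℕ.≡ᵇ 1)

egf-oddIndicator : egf oddIndicator ≈S sinhS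
egf-oddIndicator = mk≈ λ k → coeff (parity k)
  where
  coeff : ∀ {k} → Parity k → egf oddIndicator k ≡ sinhS k
  coeff (even m) = trans (cong (λ r → 𝟙 (r ℕ.≡ᵇ 1) * invFact (m ℕ.* 2)) (m*n%n≡0 m 2))
                         (trans (*-zeroˡ (invFact (m ℕ.* 2))) (sym (sinhS-even m)))
  coeff (odd m)  = trans (cong (λ r → 𝟙 (r ℕ.≡ᵇ 1) * invFact (suc (m ℕ.* 2))) ([m+kn]%n≡m%n 1 m 2))
                         (trans (*-identityˡ (invFact (suc (m ℕ.* 2)))) (sym (sinhS-odd m)))

egfProduct-oddIndicators : ∀ l → egfProduct (List.replicate l oddIndicator) ≈S sinhS ^S l
egfProduct-oddIndicators zero    = SR.refl
egfProduct-oddIndicators (suc l) = SR.*-cong egf-oddIndicator (egfProduct-oddIndicators l)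

𝟙-isOdd : ∀ {n} (φ : List (Subset n)) → 𝟙 (isOdd φ) ≡ blockWeight (List.replicate (length φ) oddIndicator) φ
𝟙-isOdd []      = refl
𝟙-isOdd (s ∷ φ) = trans (𝟙-∧ (∣ s ∣ % 2 ℕ.≡ᵇ 1) (isOdd φ)) (cong (oddIndicator ∣ s ∣ *_) (𝟙-isOdd φ))

blocksNonempty∧isOdd : ∀ {n} (φ : List (Subset n)) → blocksNonempty φ ∧ isOdd φ ≡ isOdd φ
blocksNonempty∧isOdd []      = refl
blocksNonempty∧isOdd (s ∷ φ) = absorb _ (∣ s ∣ % 2 ℕ.≡ᵇ 1) (blocksNonempty φ) (isOdd φ) (odd⇒nonempty ∣ s ∣) (blocksNonempty∧isOdd φ)
  where
  odd⇒nonempty : ∀ k → ⌊ 1 ℕ.≤? k ⌋ ∧ (k % 2 ℕ.≡ᵇ 1) ≡ (k % 2 ℕ.≡ᵇ 1)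
  odd⇒nonempty zero    = refl
  odd⇒nonempty (suc k) = refl
  absorb : ∀ a b c d → a ∧ b ≡ b → c ∧ d ≡ d → (a ∧ c) ∧ (b ∧ d) ≡ b ∧ d
  absorb true  b     true  d _  _   = refl
  absorb true  false false d _  _   = refl
  absorb true  true  false d _  c∧d = c∧d
  absorb false false c     d _  _   = refl
  absorb false true  c     d () _

isSetComposition∧isOdd : ∀ {n} (φ : List (Subset n)) → isSetComposition φ ∧ isOdd φ ≡ exactlyOneBlock φ ∧ isOdd φ
isSetComposition∧isOdd φ with blocksNonempty φ | exactlyOneBlock φ | isOdd φ | blocksNonempty∧isOdd φ
... | true  | e | o     | _ = refl
... | false | e | false | _ = sym (∧-zeroʳ e)
... | false | e | true  | ()

odd-setComposition-indicator : ∀ {n} (φ : List (Subset n)) x →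
  (if does (isSetComposition φ Bool.≟ true) then (if does (isOdd φ Bool.≟ true) then x else 0ℚ) else 0ℚ)
    ≡ 𝟙 (exactlyOneBlock φ) * blockWeight (List.replicate (length φ) oddIndicator) φ * x
odd-setComposition-indicator φ x = begin
  (if does (isSetComposition φ Bool.≟ true) then (if does (isOdd φ Bool.≟ true) then x else 0ℚ) else 0ℚ)
    ≡⟨ if-then-else-𝟙 (isSetComposition φ) _ ⟩
  𝟙 (isSetComposition φ) * (if does (isOdd φ Bool.≟ true) then x else 0ℚ)
    ≡⟨ cong (𝟙 (isSetComposition φ) *_) (if-then-else-𝟙 (isOdd φ) x) ⟩
  𝟙 (isSetComposition φ) * (𝟙 (isOdd φ) * x)
    ≡⟨ *-assoc (𝟙 (isSetComposition φ)) (𝟙 (isOdd φ)) x ⟨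
  𝟙 (isSetComposition φ) * 𝟙 (isOdd φ) * x
    ≡⟨ cong (_* x) (trans (sym (𝟙-∧ (isSetComposition φ) (isOdd φ)))
         (trans (cong 𝟙 (isSetComposition∧isOdd φ)) (𝟙-∧ (exactlyOneBlock φ) (isOdd φ)))) ⟩
  𝟙 (exactlyOneBlock φ) * 𝟙 (isOdd φ) * x
    ≡⟨ cong (λ y → 𝟙 (exactlyOneBlock φ) * y * x) (𝟙-isOdd φ) ⟩
  𝟙 (exactlyOneBlock φ) * blockWeight (List.replicate (length φ) oddIndicator) φ * x ∎
  where open ≡-Reasoning

lhsSum-weakCompositions : ∀ n → lhsSum n ≡
  Σ (suc n) (λ l → weakCompositionSum n l (List.replicate l oddIndicator) * (ℕtoℚ (2 ^ (n ∸ l)) * μ⁺ l))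
lhsSum-weakCompositions n = begin
  lhsSum n
    ≡⟨ Σl-filter (λ φ → isOdd φ Bool.≟ true) (term ∘ length) (concatMap (setCompositions n) (upTo (suc n))) ⟩
  Σl odd-term (concatMap (setCompositions n) (upTo (suc n)))
    ≡⟨ Σl-concatMap odd-term (setCompositions n) (upTo (suc n)) ⟩
  Σl (λ l → Σl odd-term (setCompositions n l)) (upTo (suc n))
    ≡⟨ Σl-cong (upTo (suc n)) by-length ⟩
  Σl (λ l → weakCompositionSum n l (List.replicate l oddIndicator) * term l) (upTo (suc n))
    ≡⟨ sumℚ-map-upTo (suc n) _ ⟩
  Σ (suc n) (λ l → weakCompositionSum n l (List.replicate l oddIndicator) * term l) ∎
  where
  open ≡-Reasoning
  term : ℕ → ℚ
  term l = ℕtoℚ (2 ^ (n ∸ l)) * μ⁺ l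
  odd-term : List (Subset n) → ℚ
  odd-term φ = if does (isOdd φ Bool.≟ true) then term (length φ) else 0ℚ
  H : ℕ → List (Subset n) → ℚ
  H l φ = 𝟙 (exactlyOneBlock φ) * blockWeight (List.replicate l oddIndicator) φ * term l
  by-length : ∀ l → Σl odd-term (setCompositions n l) ≡ weakCompositionSum n l (List.replicate l oddIndicator) * term l
  by-length l = begin
    Σl odd-term (setCompositions n l)
      ≡⟨ Σl-filter (λ φ → isSetComposition φ Bool.≟ true) odd-term (subsetLists n l) ⟩
    Σl (λ φ → if does (isSetComposition φ Bool.≟ true) then odd-term φ else 0ℚ) (subsetLists n l)
      ≡⟨ Σl-cong (subsetLists n l) (λ φ → odd-setComposition-indicator φ (term (length φ))) ⟩
    Σl (λ φ → H (length φ) φ) (subsetLists n l)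
      ≡⟨ Σl-subsetLists-length l H ⟩
    Σl (H l) (subsetLists n l)
      ≡⟨ Σl-cong (subsetLists n l) (λ φ → *-comm _ (term l)) ⟩
    Σl (λ φ → term l * (𝟙 (exactlyOneBlock φ) * blockWeight (List.replicate l oddIndicator) φ)) (subsetLists n l)
      ≡⟨ *-distribˡ-Σl (term l) _ (subsetLists n l) ⟨
    term l * weakCompositionSum n l (List.replicate l oddIndicator)
      ≡⟨ *-comm (term l) _ ⟩
    weakCompositionSum n l (List.replicate l oddIndicator) * term l ∎

catalanPartialSum≡tanhS : ∀ n → catalanPartialSum (suc n) n ≡ tanhS n
catalanPartialSum≡tanhS n = begin
  catalanPartialSum (suc n) n            ≡⟨ +-identityʳ _ ⟨
  catalanPartialSum (suc n) n + 0ℚ       ≡⟨ cong (catalanPartialSum (suc n) n +_) top-term≡0 ⟨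
  S n                                    ≡⟨ ℚ-Group.x∙y⁻¹≈ε⇒x≈y (S n) (tanhS n) (q∂r+r-uniqueness q refl refl r n q∂r+r≡0 n ℕ.≤-refl) ⟩
  tanhS n                                ∎
  where
  open ≡-Reasoning
  S = catalanPartialSum (2 ℕ.+ n)
  r = S ⊖ tanhS
  top-term≡0 : (constS (μ⁺ (suc n)) ⊗ Y ^S suc n) n ≡ 0ℚ
  top-term≡0 = trans (coeff-constS-*S (μ⁺ (suc n)) (Y ^S suc n) n)
    (trans (cong (μ⁺ (suc n) *_) (^S-low Y refl (suc n) n (ℕ.n<1+n n))) (*-zeroʳ (μ⁺ (suc n))))
  q∂r+r≈residual⊖0 : q ⊗ ∂ r ⊕ r ≈S residual (2 ℕ.+ n) ⊖ (q ⊗ ∂ tanhS ⊕ tanhS ⊖ constS 2ℚ ⊗ Y)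
  q∂r+r≈residual⊖0 = SR.trans (SR.+-congʳ {r} (SR.*-congˡ {q} (∂-homo-⊖ S tanhS)))
    (solve 6 (λ q a b s t y → q :* (a :- b) :+ (s :- t) := (q :* a :+ s :- y) :- (q :* b :+ t :- y))
       SR.refl q (∂ S) (∂ tanhS) S tanhS (constS 2ℚ ⊗ Y))
  q∂r+r≡0 : ∀ k → k ≤ n → (q ⊗ ∂ r ⊕ r) k ≡ 0ℚ
  q∂r+r≡0 k k≤n = begin
    (q ⊗ ∂ r ⊕ r) k                                                   ≡⟨ at q∂r+r≈residual⊖0 k ⟩
    residual (2 ℕ.+ n) k + - (q ⊗ ∂ tanhS ⊕ tanhS ⊖ constS 2ℚ ⊗ Y) k  ≡⟨ cong₂ (λ a b → a + - b) (residual-low n k (s≤s (ℕ.m≤n⇒m≤1+n k≤n)))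
                                                                            (at (x≈y⇒x∙y⁻¹≈ε tanhS-ode) k) ⟩
    0ℚ                                                                ∎

lhsSum≡n!*tanhS : ∀ n → lhsSum n ≡ ℕtoℚ (n !) * tanhS n
lhsSum≡n!*tanhS n = begin
  lhsSum n
    ≡⟨ lhsSum-weakCompositions n ⟩
  Σ (suc n) (λ l → weakCompositionSum n l (List.replicate l oddIndicator) * (ℕtoℚ (2 ^ (n ∸ l)) * μ⁺ l))
    ≡⟨ Σ-cong (suc n) (λ l l≤n → term l (ℕ.≤-pred l≤n)) ⟩
  Σ (suc n) (λ l → ℕtoℚ (n !) * (μ⁺ l * (Y ^S l) n))
    ≡⟨ *-distribˡ-Σ (suc n) (ℕtoℚ (n !)) _ ⟨
  ℕtoℚ (n !) * Σ (suc n) (λ l → μ⁺ l * (Y ^S l) n)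
    ≡⟨ cong (ℕtoℚ (n !) *_) (trans (sym (coeff-catalanPartialSum (suc n) n)) (catalanPartialSum≡tanhS n)) ⟩
  ℕtoℚ (n !) * tanhS n ∎
  where
  open ≡-Reasoning
  term : ∀ l → l ≤ n → weakCompositionSum n l (List.replicate l oddIndicator) * (ℕtoℚ (2 ^ (n ∸ l)) * μ⁺ l)
                      ≡ ℕtoℚ (n !) * (μ⁺ l * (Y ^S l) n)
  term l l≤n = begin
    weakCompositionSum n l (List.replicate l oddIndicator) * (ℕtoℚ (2 ^ (n ∸ l)) * μ⁺ l)
      ≡⟨ cong (λ k → weakCompositionSum n k (List.replicate l oddIndicator) * (ℕtoℚ (2 ^ (n ∸ l)) * μ⁺ l))
              (sym (length-replicate l)) ⟩
    weakCompositionSum n (length (List.replicate l oddIndicator)) (List.replicate l oddIndicator) * (ℕtoℚ (2 ^ (n ∸ l)) * μ⁺ l)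
      ≡⟨ cong (_* (ℕtoℚ (2 ^ (n ∸ l)) * μ⁺ l)) (trans (weakCompositionSum-egf n (List.replicate l oddIndicator))
                                                     (cong (ℕtoℚ (n !) *_) (at (egfProduct-oddIndicators l) n))) ⟩
    ℕtoℚ (n !) * (sinhS ^S l) n * (ℕtoℚ (2 ^ (n ∸ l)) * μ⁺ l)
      ≡⟨ rearrange (ℕtoℚ (n !)) ((sinhS ^S l) n) (ℕtoℚ (2 ^ (n ∸ l))) (μ⁺ l) ⟩
    ℕtoℚ (n !) * (μ⁺ l * (ℕtoℚ (2 ^ (n ∸ l)) * (sinhS ^S l) n))
      ≡⟨ cong (λ x → ℕtoℚ (n !) * (μ⁺ l * x)) (2^[n∸l]*coeff-sinh^l n l l≤n) ⟩
    ℕtoℚ (n !) * (μ⁺ l * (Y ^S l) n) ∎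
    where
    rearrange : ∀ a b c d → a * b * (c * d) ≡ a * (d * (c * b))
    rearrange = solve-∀ ℚ-ring

mainTheorem1 : (n : ℕ) → n % 2 ≡ 1 →
    lhsSum n ≡ signℚ ((n ∸ 1) / 2) * euler n
mainTheorem1 n n-odd with parity n
... | even m = ⊥-elim (ℕ.0≢1+n (trans (sym (m*n%n≡0 m 2)) n-odd))
... | odd m  = begin
  lhsSum (suc (m ℕ.* 2))                                               ≡⟨ lhsSum≡n!*tanhS (suc (m ℕ.* 2)) ⟩
  ℕtoℚ (suc (m ℕ.* 2) !) * tanhS (suc (m ℕ.* 2))                       ≡⟨ cong (ℕtoℚ (suc (m ℕ.* 2) !) *_) (tanhS-odd m) ⟩
  ℕtoℚ (suc (m ℕ.* 2) !) * (signℚ m * tanPlusSec (suc (m ℕ.* 2)))      ≡⟨ x∙yz≈y∙xz (ℕtoℚ (suc (m ℕ.* 2) !)) (signℚ m) _ ⟩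
  signℚ m * euler (suc (m ℕ.* 2))                                      ≡⟨ cong (λ k → signℚ k * euler (suc (m ℕ.* 2))) (m*n/n≡m m 2) ⟨
  signℚ ((suc (m ℕ.* 2) ∸ 1) / 2) * euler (suc (m ℕ.* 2))              ∎
  where open ≡-Reasoning
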